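{- Let $B\in\{1,\dots,9\}$, let $\tilde p\neq0$ be an integer and $\tilde q$ a positive integer with $\tilde q\geqslant 7\sqrt[3]{|\tilde p|}$. Put $F_3=B\tilde q^{4}-\tilde p\tilde q+\frac{16}{B}$. Then the equation $\tilde Q(t)=0$ has at least one real root $t$ with $F_3+\frac{32\tilde p}{B^{2}\tilde q^{3}}<t<F_3$ if $\tilde p<0$, respectively with $F_3<t<F_3+\frac{32\tilde p}{B^{2}\tilde q^{3}}$ if $\tilde p>0$.
   Context: For numbers $p,q$ let $$Q_{pq}(t)=t^{10}+(2q^{2}+p^{2})(3q^{2}-2p^{2})\,t^{8}+(q^{8}+10p^{2}q^{6}+4p^{4}q^{4}-14p^{6}q^{2}+p^{8})\,t^{6}-p^{2}q^{2}(q^{8}-14p^{2}q^{6}+4p^{4}q^{4}+10p^{6}q^{2}+p^{8})\,t^{4}-p^{6}q^{6}(q^{2}+2p^{2})(3p^{2}-2q^{2})\,t^{2}-q^{10}p^{10}.$$ Given $B$, $\tilde p$, $\tilde q$, define $\tilde Q(t)=Q_{pq}(t)$ with $p=B\tilde q^{3}-\tilde p$ and $q=\tilde q$. -}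

module Defs where

open import Data.Nat as ℕ using (ℕ; zero; suc)
open import Data.Integer as ℤ using (ℤ; +_)
open import Data.Rational using (ℚ; 0ℚ; 1ℚ; _/_; _+_; _-_; _*_; -_; ∣_∣; _≤_; _<_)
open import Data.Product using (Σ; ∃; _×_)

infixr 8 _^_
_^_ : ℚ → ℕ → ℚ
x ^ zero = 1ℚ
x ^ suc n = x * (x ^ n)

ι : ℤ → ℚ
ι n = n / 1

-- n / d as a rational (d = 0 is never used: callers ensure d ≥ 1)
over : ℤ → ℕ → ℚ
over n zero = 0ℚ
over n (suc d) = n / suc d

Q : ℚ → ℚ → ℚ → ℚ
Q p q t =
  t ^ 10
  + (ι (+ 2) * q ^ 2 + p ^ 2) * (ι (+ 3) * q ^ 2 - ι (+ 2) * p ^ 2) * t ^ 8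
  + (q ^ 8 + ι (+ 10) * p ^ 2 * q ^ 6 + ι (+ 4) * p ^ 4 * q ^ 4
       - ι (+ 14) * p ^ 6 * q ^ 2 + p ^ 8) * t ^ 6
  - p ^ 2 * q ^ 2 * (q ^ 8 - ι (+ 14) * p ^ 2 * q ^ 6 + ι (+ 4) * p ^ 4 * q ^ 4
       + ι (+ 10) * p ^ 6 * q ^ 2 + p ^ 8) * t ^ 4
  - p ^ 6 * q ^ 6 * (q ^ 2 + ι (+ 2) * p ^ 2) * (ι (+ 3) * p ^ 2 - ι (+ 2) * q ^ 2) * t ^ 2
  - q ^ 10 * p ^ 10

Qtilde : ℕ → ℤ → ℕ → ℚ → ℚ
Qtilde B pt qt t = Q (ι (+ B) * ι (+ qt) ^ 3 - ι pt) (ι (+ qt)) t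

-- Real numbers (Bishop): regular sequences of rationals,
-- |x m - x n| ≤ 1/(m+1) + 1/(n+1).

recip : ℕ → ℚ
recip n = + 1 / suc n

IsRegular : (ℕ → ℚ) → Set
IsRegular x = ∀ m n → ∣ x m - x n ∣ ≤ recip m + recip n

_<ᴿ_ : ℚ → (ℕ → ℚ) → Set
a <ᴿ x = ∃ λ n → a < x n - recip n

_<ᴸ_ : (ℕ → ℚ) → ℚ → Set
x <ᴸ b = ∃ λ n → x n + recip n < b

-- f(x) = 0 for the real x, f a polynomial (hence continuous):
-- f (x n) → 0
ZeroAt : (ℚ → ℚ) → (ℕ → ℚ) → Set
ZeroAt f x = ∀ k → ∃ λ N → ∀ n → N ℕ.≤ n → ∣ f (x n) ∣ ≤ recip k

HasRealRootIn : (ℚ → ℚ) → ℚ → ℚ → Set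
HasRealRootIn f a b =
  Σ (ℕ → ℚ) λ x → IsRegular x × (a <ᴿ x) × (x <ᴸ b) × ZeroAt f x

F3 : ℕ → ℤ → ℕ → ℚ
F3 B pt qt = ι (+ B) * ι (+ qt) ^ 4 - ι pt * ι (+ qt) + over (+ 16) B

D : ℕ → ℤ → ℕ → ℚ
D B pt qt = over (ℤ.+ 32 ℤ.* pt) (B ℕ.^ 2 ℕ.* qt ℕ.^ 3)

-- Write P = B q̃³ − p̃ and k = |p̃|, so that P + p̃ = B q̃³. Multiplying by (P + p̃)¹⁰, resp. (P + p̃)²⁰,
-- clears the denominators of F₃ and F₃ + D and turns p̃ Q̃(F₃) and p̃ Q̃(F₃ + D) into polynomials
-- in P, q̃ and k (one pair for each sign of p̃). The hypothesis q̃³ ≥ 343 k gives 6 q̃² ≤ P k and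
-- 342 k ≤ P; trading q̃² for P k / 6 and k for P / 342 bounds every monomial by a multiple of the
-- leading monomial P^D q̃⁸ k², whose coefficient outweighs all the others together (an integer
-- certificate checked by evaluation). Hence p̃ Q̃(F₃) < 0 < p̃ Q̃(F₃ + D), and bisection produces a
-- regular sequence of rationals converging to a root between the two points.

module Submission where

open import Defs
open import Data.Nat as ℕ using (ℕ; zero; suc)
open import Data.Integer as ℤ using (ℤ; +_; -[1+_]; ∣_∣)
open import Data.Rational using (_+_)
open import Data.Product using (_×_)
open import Relation.Nullary using (¬_)
open import Relation.Binary.PropositionalEquality using (_≡_)

import Data.Nat.Properties as ℕP
import Data.Integer.Properties as ℤP
open import Data.Rational as ℚ
  using (ℚ; mkℚ; 0ℚ; 1ℚ; ½; _*_; -_; _-_; _≤_; _<_; toℚᵘ; positive; nonNegative)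
import Data.Rational.Properties as ℚP
open import Data.Rational.Unnormalised as ℚᵘ using (mkℚᵘ; *≡*; *≤*)
import Data.Rational.Unnormalised.Properties as ℚᵘP
open import Data.Bool using (Bool; true; false; if_then_else_)
open import Data.Fin using (Fin; zero; suc)
open import Data.Vec using (Vec; []; _∷_; lookup)
open import Data.List using (List; []; _∷_)
open import Data.Maybe using (Maybe; just; nothing)
open import Data.Product using (∃; _,_; proj₁; proj₂; map₂)
open import Data.Sum using (_⊎_; inj₁; inj₂)
open import Data.Empty using (⊥-elim)
open import Relation.Nullary using (yes; no)
open import Relation.Binary.PropositionalEquality using (refl; sym; trans; cong; cong₂; subst; subst₂; module ≡-Reasoning)
open import Level using (0ℓ)
open import Tactic.RingSolver.Core.AlmostCommutativeRing using (AlmostCommutativeRing; fromCommutativeRing)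
open import Tactic.RingSolver using (solve-∀)
open import Algebra.Properties.CommutativeSemigroup ℕP.*-commutativeSemigroup using () renaming (interchange to *-interchange)

ℚ-ring : AlmostCommutativeRing 0ℓ 0ℓ
ℚ-ring = fromCommutativeRing ℚP.+-*-commutativeRing 0≟
  where
  0≟ : (x : ℚ) → Maybe (0ℚ ≡ x)
  0≟ x with 0ℚ ℚP.≟ x
  ... | yes e = just e
  ... | no _ = nothing

ι≃ : ∀ z → toℚᵘ (ι z) ℚᵘ.≃ mkℚᵘ z 0
ι≃ z = ℚP.toℚᵘ-fromℚᵘ (mkℚᵘ z 0)

ι-homo-+ : ∀ a b → ι (a ℤ.+ b) ≡ ι a + ι b
ι-homo-+ a b = ℚP.toℚᵘ-injective (begin
  toℚᵘ (ι (a ℤ.+ b))          ≈⟨ ι≃ (a ℤ.+ b) ⟩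
  mkℚᵘ (a ℤ.+ b) 0            ≈⟨ *≡* (cong (ℤ._* + 1) (sym (cong₂ ℤ._+_ (ℤP.*-identityʳ a) (ℤP.*-identityʳ b)))) ⟩
  mkℚᵘ a 0 ℚᵘ.+ mkℚᵘ b 0      ≈⟨ ℚᵘP.+-cong (ℚᵘP.≃-sym (ι≃ a)) (ℚᵘP.≃-sym (ι≃ b)) ⟩
  toℚᵘ (ι a) ℚᵘ.+ toℚᵘ (ι b)  ≈⟨ ℚᵘP.≃-sym (ℚP.toℚᵘ-homo-+ (ι a) (ι b)) ⟩
  toℚᵘ (ι a + ι b)            ∎)
  where open ℚᵘP.≃-Reasoning

ι-homo-* : ∀ a b → ι (a ℤ.* b) ≡ ι a * ι b
ι-homo-* a b = ℚP.toℚᵘ-injective (begin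
  toℚᵘ (ι (a ℤ.* b))          ≈⟨ ι≃ (a ℤ.* b) ⟩
  mkℚᵘ a 0 ℚᵘ.* mkℚᵘ b 0      ≈⟨ ℚᵘP.*-cong (ℚᵘP.≃-sym (ι≃ a)) (ℚᵘP.≃-sym (ι≃ b)) ⟩
  toℚᵘ (ι a) ℚᵘ.* toℚᵘ (ι b)  ≈⟨ ℚᵘP.≃-sym (ℚP.toℚᵘ-homo-* (ι a) (ι b)) ⟩
  toℚᵘ (ι a * ι b)            ∎)
  where open ℚᵘP.≃-Reasoning

ι-homo‿- : ∀ a → ι (ℤ.- a) ≡ - ι a
ι-homo‿- a = ℚP.toℚᵘ-injective (begin
  toℚᵘ (ι (ℤ.- a))      ≈⟨ ι≃ (ℤ.- a) ⟩
  ℚᵘ.- mkℚᵘ a 0         ≈⟨ ℚᵘP.-‿cong (ℚᵘP.≃-sym (ι≃ a)) ⟩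
  ℚᵘ.- toℚᵘ (ι a)       ≈⟨ ℚᵘP.≃-sym (ℚP.toℚᵘ-homo‿- (ι a)) ⟩
  toℚᵘ (- ι a)          ∎)
  where open ℚᵘP.≃-Reasoning

ιℕ : ℕ → ℚ
ιℕ n = ι (+ n)

ιℕ-homo-+ : ∀ m n → ιℕ (m ℕ.+ n) ≡ ιℕ m + ιℕ n
ιℕ-homo-+ m n = trans (cong ι (ℤP.pos-+ m n)) (ι-homo-+ (+ m) (+ n))

ιℕ-homo-* : ∀ m n → ιℕ (m ℕ.* n) ≡ ιℕ m * ιℕ n
ιℕ-homo-* m n = trans (cong ι (ℤP.pos-* m n)) (ι-homo-* (+ m) (+ n))

ιℕ-homo-^ : ∀ m n → ιℕ (m ℕ.^ n) ≡ ιℕ m ^ n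
ιℕ-homo-^ m zero = refl
ιℕ-homo-^ m (suc n) = trans (ιℕ-homo-* m (m ℕ.^ n)) (cong (ιℕ m *_) (ιℕ-homo-^ m n))

ιℕ-nonNeg : ∀ n → 0ℚ ≤ ιℕ n
ιℕ-nonNeg n = ℚP.nonNegative⁻¹ (ιℕ n) {{ℚP.normalize-nonNeg n 1}}

ιℕ-pos : ∀ n .{{_ : ℕ.NonZero n}} → 0ℚ < ιℕ n
ιℕ-pos n = ℚP.positive⁻¹ (ιℕ n) {{ℚP.normalize-pos n 1}}

ιℕ-mono-≤ : ∀ {m n} → m ℕ.≤ n → ιℕ m ≤ ιℕ n
ιℕ-mono-≤ {m} m≤n with ℕP.m≤n⇒∃[o]m+o≡n m≤n
... | o , refl = begin
  ιℕ m           ≡⟨ ℚP.+-identityʳ (ιℕ m) ⟨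
  ιℕ m + 0ℚ      ≤⟨ ℚP.+-monoʳ-≤ (ιℕ m) (ιℕ-nonNeg o) ⟩
  ιℕ m + ιℕ o    ≡⟨ ιℕ-homo-+ m o ⟨
  ιℕ (m ℕ.+ o)   ∎
  where open ℚP.≤-Reasoning

ιℕ<ιℕ-suc : ∀ n → ιℕ n < ιℕ (suc n)
ιℕ<ιℕ-suc n = begin-strict
  ιℕ n          ≡⟨ ℚP.+-identityʳ (ιℕ n) ⟨
  ιℕ n + 0ℚ     <⟨ ℚP.+-monoʳ-< (ιℕ n) (ℚP.positive⁻¹ 1ℚ) ⟩
  ιℕ n + 1ℚ     ≡⟨ ιℕ-homo-+ n 1 ⟨
  ιℕ (n ℕ.+ 1)  ≡⟨ cong ιℕ (ℕP.+-comm n 1) ⟩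
  ιℕ (suc n)    ∎
  where open ℚP.≤-Reasoning

ιℕ*over : ∀ z {n} → 1 ℕ.≤ n → ιℕ n * over z n ≡ ι z
ιℕ*over z {suc n} _ = ℚP.toℚᵘ-injective (begin
  toℚᵘ (ιℕ (suc n) * over z (suc n))            ≈⟨ ℚP.toℚᵘ-homo-* (ιℕ (suc n)) (over z (suc n)) ⟩
  toℚᵘ (ιℕ (suc n)) ℚᵘ.* toℚᵘ (over z (suc n))  ≈⟨ ℚᵘP.*-cong (ι≃ (+ suc n)) (ℚP.toℚᵘ-fromℚᵘ (mkℚᵘ z n)) ⟩
  mkℚᵘ (+ suc n) 0 ℚᵘ.* mkℚᵘ z n                ≈⟨ *≡* cross ⟩
  mkℚᵘ z 0                                      ≈⟨ ℚᵘP.≃-sym (ι≃ z) ⟩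
  toℚᵘ (ι z)                                    ∎)
  where
  open ℚᵘP.≃-Reasoning
  cross : (+ suc n ℤ.* z) ℤ.* + 1 ≡ z ℤ.* + (1 ℕ.* suc n)
  cross = trans (ℤP.*-identityʳ _) (trans (ℤP.*-comm (+ suc n) z) (cong (λ d → z ℤ.* + d) (sym (ℕP.*-identityˡ (suc n)))))

*-monoˡ-≤ : ∀ {r x y} → 0ℚ ≤ r → x ≤ y → r * x ≤ r * y
*-monoˡ-≤ {r} 0≤r = ℚP.*-monoˡ-≤-nonNeg r {{nonNegative 0≤r}}

*-monoʳ-≤ : ∀ {r x y} → 0ℚ ≤ r → x ≤ y → x * r ≤ y * r
*-monoʳ-≤ {r} 0≤r = ℚP.*-monoʳ-≤-nonNeg r {{nonNegative 0≤r}}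

*-cancelˡ-< : ∀ {r x y} → 0ℚ ≤ r → r * x < r * y → x < y
*-cancelˡ-< {r} 0≤r = ℚP.*-cancelˡ-<-nonNeg r {{nonNegative 0≤r}}

*-cancelˡ-≤ : ∀ {r x y} → 0ℚ < r → r * x ≤ r * y → x ≤ y
*-cancelˡ-≤ {r} 0<r = ℚP.*-cancelˡ-≤-pos r {{positive 0<r}}

*-nonNeg : ∀ {x y} → 0ℚ ≤ x → 0ℚ ≤ y → 0ℚ ≤ x * y
*-nonNeg {x} {y} 0≤x 0≤y =
  ℚP.nonNegative⁻¹ (x * y) {{ℚP.nonNeg*nonNeg⇒nonNeg x {{nonNegative 0≤x}} y {{nonNegative 0≤y}}}}

*-pos : ∀ {x y} → 0ℚ < x → 0ℚ < y → 0ℚ < x * y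
*-pos {x} {y} 0<x 0<y = ℚP.positive⁻¹ (x * y) {{ℚP.pos*pos⇒pos x {{positive 0<x}} y {{positive 0<y}}}}

^-nonNeg : ∀ {x} n → 0ℚ ≤ x → 0ℚ ≤ x ^ n
^-nonNeg zero _ = ℚP.nonNegative⁻¹ 1ℚ
^-nonNeg (suc n) 0≤x = *-nonNeg 0≤x (^-nonNeg n 0≤x)

^-pos : ∀ {x} n → 0ℚ < x → 0ℚ < x ^ n
^-pos zero _ = ℚP.positive⁻¹ 1ℚ
^-pos (suc n) 0<x = *-pos 0<x (^-pos n 0<x)

^-+ : ∀ x m n → x ^ (m ℕ.+ n) ≡ x ^ m * x ^ n
^-+ x zero n = sym (ℚP.*-identityˡ (x ^ n))
^-+ x (suc m) n = trans (cong (x *_) (^-+ x m n)) (sym (ℚP.*-assoc x (x ^ m) (x ^ n)))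

*-pos⇒pos : ∀ {x y} → 0ℚ ≤ x → 0ℚ < x * y → 0ℚ < y
*-pos⇒pos {x} {y} 0≤x 0<xy with 0ℚ ℚP.<? y
... | yes 0<y = 0<y
... | no 0≮y = ⊥-elim (ℚP.<-irrefl refl (ℚP.<-≤-trans 0<xy (begin
  x * y   ≤⟨ *-monoˡ-≤ 0≤x (ℚP.≮⇒≥ 0≮y) ⟩
  x * 0ℚ  ≡⟨ ℚP.*-zeroʳ x ⟩
  0ℚ      ∎)))
  where open ℚP.≤-Reasoning

*-neg⇒neg : ∀ {x y} → 0ℚ < x → x * y < 0ℚ → y < 0ℚ
*-neg⇒neg {x} {y} 0<x xy<0 with y ℚP.<? 0ℚ
... | yes y<0 = y<0
... | no y≮0 = ⊥-elim (ℚP.<-irrefl refl (ℚP.<-≤-trans xy<0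
  (*-nonNeg (ℚP.<⇒≤ 0<x) (ℚP.≮⇒≥ y≮0))))

p≤q⇒0≤q-p : ∀ {p q} → p ≤ q → 0ℚ ≤ q - p
p≤q⇒0≤q-p {p} {q} p≤q = subst (_≤ q - p) (ℚP.+-inverseʳ p) (ℚP.+-monoˡ-≤ (- p) p≤q)

p<q⇒0<q-p : ∀ {p q} → p < q → 0ℚ < q - p
p<q⇒0<q-p {p} {q} p<q = subst (_< q - p) (ℚP.+-inverseʳ p) (ℚP.+-monoˡ-< (- p) p<q)

q-p+p≡q : ∀ p q → q - p + p ≡ q
q-p+p≡q = solve-∀ ℚ-ring

0≤q-p⇒p≤q : ∀ {p q} → 0ℚ ≤ q - p → p ≤ q
0≤q-p⇒p≤q {p} {q} 0≤q-p = subst₂ _≤_ (ℚP.+-identityˡ p) (q-p+p≡q p q) (ℚP.+-monoˡ-≤ p 0≤q-p)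

0<q-p⇒p<q : ∀ {p q} → 0ℚ < q - p → p < q
0<q-p⇒p<q {p} {q} 0<q-p = subst₂ _<_ (ℚP.+-identityˡ p) (q-p+p≡q p q) (ℚP.+-monoˡ-< p 0<q-p)

p≤p+q : ∀ {p q} → 0ℚ ≤ q → p ≤ p + q
p≤p+q {p} {q} 0≤q = subst (_≤ p + q) (ℚP.+-identityʳ p) (ℚP.+-monoʳ-≤ p 0≤q)

p≤q+p : ∀ {p q} → 0ℚ ≤ q → p ≤ q + p
p≤q+p {p} {q} 0≤q = subst (_≤ q + p) (ℚP.+-identityˡ p) (ℚP.+-monoˡ-≤ p 0≤q)

+-cancelʳ-< : ∀ r {p q} → p + r < q + r → p < q
+-cancelʳ-< r {p} {q} p+r<q+r = subst₂ _<_ (p+r-r≡p p r) (p+r-r≡p q r) (ℚP.+-monoˡ-< (- r) p+r<q+r)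
  where
  p+r-r≡p : ∀ p r → p + r - r ≡ p
  p+r-r≡p = solve-∀ ℚ-ring

∣p-q∣≡∣q-p∣ : ∀ p q → ℚ.∣ p - q ∣ ≡ ℚ.∣ q - p ∣
∣p-q∣≡∣q-p∣ p q = trans (sym (ℚP.∣-p∣≡∣p∣ (p - q))) (cong ℚ.∣_∣ (neg-diff p q))
  where
  neg-diff : ∀ p q → - (p - q) ≡ q - p
  neg-diff = solve-∀ ℚ-ring

0<-p⇒p<0 : ∀ {p} → 0ℚ < - p → p < 0ℚ
0<-p⇒p<0 {p} 0<-p with p ℚP.<? 0ℚ
... | yes p<0 = p<0
... | no p≮0 = ⊥-elim (ℚP.<-irrefl refl (ℚP.<-≤-trans 0<-p (ℚP.neg-antimono-≤ (ℚP.≮⇒≥ p≮0))))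

neg*pos⇒neg : ∀ {x y} → x < 0ℚ → 0ℚ < x * y → y < 0ℚ
neg*pos⇒neg {x} {y} x<0 0<xy = *-neg⇒neg (ℚP.neg-antimono-< x<0)
  (subst (_< 0ℚ) (ℚP.neg-distribˡ-* x y) (ℚP.neg-antimono-< 0<xy))

neg*neg⇒pos : ∀ {x y} → x < 0ℚ → x * y < 0ℚ → 0ℚ < y
neg*neg⇒pos {x} {y} x<0 xy<0 = *-pos⇒pos (ℚP.<⇒≤ (ℚP.neg-antimono-< x<0))
  (subst (0ℚ <_) (ℚP.neg-distribˡ-* x y) (ℚP.neg-antimono-< xy<0))

p+q≤p : ∀ {p q} → q ≤ 0ℚ → p + q ≤ p
p+q≤p {p} {q} q≤0 = subst (p + q ≤_) (ℚP.+-identityʳ p) (ℚP.+-monoʳ-≤ p q≤0)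

ℚ≤ιℕ : ∀ x → ∃ λ n → x ≤ ιℕ n
ℚ≤ιℕ (mkℚ (+ m) d _) = m , ℚP.toℚᵘ-cancel-≤ (ℚᵘP.≤-respʳ-≃ (ℚᵘP.≃-sym (ι≃ (+ m))) (*≤* m≤m*d))
  where
  m≤m*d : + m ℤ.* + 1 ℤ.≤ + m ℤ.* + suc d
  m≤m*d = subst₂ ℤ._≤_ (ℤP.pos-* m 1) (ℤP.pos-* m (suc d)) (ℤ.+≤+ (ℕP.*-monoʳ-≤ m (ℕ.s≤s ℕ.z≤n)))
ℚ≤ιℕ (mkℚ -[1+ m ] d _) = 0 , ℚP.toℚᵘ-cancel-≤ (ℚᵘP.≤-respʳ-≃ (ℚᵘP.≃-sym (ι≃ (+ 0))) (*≤* ℤ.-≤+))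

recip-pos : ∀ n → 0ℚ < recip n
recip-pos n = ℚP.positive⁻¹ (recip n) {{ℚP.normalize-pos 1 (suc n)}}

ιℕ*recip : ∀ n → ιℕ (suc n) * recip n ≡ 1ℚ
ιℕ*recip n = ιℕ*over (+ 1) {suc n} (ℕ.s≤s ℕ.z≤n)

*recip-eventually< : ∀ A δ → 0ℚ < δ → ∃ λ N → ∀ n → N ℕ.≤ n → ιℕ A * recip n < δ
*recip-eventually< A δ 0<δ = M , λ n M≤n → *-cancelˡ-< (ιℕ-nonNeg (suc n)) (begin-strict
  ιℕ (suc n) * (ιℕ A * recip n)  ≡⟨ swap (ιℕ (suc n)) (ιℕ A) (recip n) ⟩
  ιℕ A * (ιℕ (suc n) * recip n)  ≡⟨ cong (ιℕ A *_) (ιℕ*recip n) ⟩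
  ιℕ A * 1ℚ                      ≡⟨ cong (ιℕ A *_) (ℚP.*-inverseˡ δ) ⟨
  ιℕ A * (1/δ * δ)               ≡⟨ ℚP.*-assoc (ιℕ A) 1/δ δ ⟨
  ιℕ A * 1/δ * δ                 ≤⟨ *-monoʳ-≤ (ℚP.<⇒≤ 0<δ) A/δ≤M ⟩
  ιℕ M * δ                       ≤⟨ *-monoʳ-≤ (ℚP.<⇒≤ 0<δ) (ιℕ-mono-≤ M≤n) ⟩
  ιℕ n * δ                       <⟨ ℚP.*-monoˡ-<-pos δ {{positive 0<δ}} (ιℕ<ιℕ-suc n) ⟩
  ιℕ (suc n) * δ                 ∎)
  where
  open ℚP.≤-Reasoning
  instance
    δ≢0 : ℚ.NonZero δ
    δ≢0 = ℚP.pos⇒nonZero δ {{positive 0<δ}}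
  1/δ : ℚ
  1/δ = ℚ.1/ δ
  M = proj₁ (ℚ≤ιℕ (ιℕ A * 1/δ))
  A/δ≤M = proj₂ (ℚ≤ιℕ (ιℕ A * 1/δ))
  swap : ∀ x y z → x * (y * z) ≡ y * (x * z)
  swap = solve-∀ ℚ-ring

n<2^n : ∀ n → n ℕ.< 2 ℕ.^ n
n<2^n zero = ℕ.s≤s ℕ.z≤n
n<2^n (suc n) = ℕP.+-mono-≤-< (ℕP.m^n>0 2 n) (ℕP.<-≤-trans (n<2^n n) (ℕP.m≤m+n (2 ℕ.^ n) 0))

-- Bisection

LipschitzOn : (ℚ → ℚ) → ℚ → ℚ → ℕ → Set
LipschitzOn f a b L = ∀ x y → a ≤ x → x ≤ y → y ≤ b → f y - f x ≤ ιℕ (suc L) * (y - x)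

r<q-p⇒p<q-r : ∀ {p q r} → r < q - p → p < q - r
r<q-p⇒p<q-r {p} {q} {r} r<q-p = 0<q-p⇒p<q (subst (0ℚ <_) (rearrange p q r) (p<q⇒0<q-p r<q-p))
  where
  rearrange : ∀ p q r → q - p - r ≡ q - r - p
  rearrange = solve-∀ ℚ-ring

r<q-p⇒p+r<q : ∀ {p q r} → r < q - p → p + r < q
r<q-p⇒p+r<q {p} {q} {r} r<q-p = 0<q-p⇒p<q (subst (0ℚ <_) (rearrange p q r) (p<q⇒0<q-p r<q-p))
  where
  rearrange : ∀ p q r → q - p - r ≡ q - (p + r)
  rearrange = solve-∀ ℚ-ring

midpoint : ℚ → ℚ → ℚ
midpoint l h = (l + h) * ½

midpoint-l : ∀ l h → midpoint l h - l ≡ (h - l) * ½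
midpoint-l = expanded
  where
  expanded : ∀ l h → (l + h) * ½ - l ≡ (h - l) * ½
  expanded = solve-∀ ℚ-ring

h-midpoint : ∀ l h → h - midpoint l h ≡ (h - l) * ½
h-midpoint = expanded
  where
  expanded : ∀ l h → h - (l + h) * ½ ≡ (h - l) * ½
  expanded = solve-∀ ℚ-ring

l≤midpoint : ∀ {l h} → l ≤ h → l ≤ midpoint l h
l≤midpoint {l} {h} l≤h = 0≤q-p⇒p≤q (subst (0ℚ ≤_) (sym (midpoint-l l h))
  (*-nonNeg (p≤q⇒0≤q-p l≤h) (ℚP.nonNegative⁻¹ ½)))

midpoint≤h : ∀ {l h} → l ≤ h → midpoint l h ≤ h
midpoint≤h {l} {h} l≤h = 0≤q-p⇒p≤q (subst (0ℚ ≤_) (sym (h-midpoint l h))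
  (*-nonNeg (p≤q⇒0≤q-p l≤h) (ℚP.nonNegative⁻¹ ½)))

half-width : ∀ l h n → (h - l) * ½ * ιℕ (2 ℕ.^ suc n) ≡ (h - l) * ιℕ (2 ℕ.^ n)
half-width l h n = trans (cong ((h - l) * ½ *_) (ιℕ-homo-* 2 (2 ℕ.^ n))) (cancel-½ (h - l) (ιℕ (2 ℕ.^ n)))
  where
  cancel-½ : ∀ w x → w * ½ * (ιℕ 2 * x) ≡ w * x
  cancel-½ = solve-∀ ℚ-ring

module Bisection (f : ℚ → ℚ) (a b : ℚ) where

  halve : ℚ × ℚ → ℚ × ℚ
  halve (l , h) with f (midpoint l h) ℚP.<? 0ℚ
  ... | yes _ = midpoint l h , h
  ... | no _ = l , midpoint l h

  interval : ℕ → ℚ × ℚ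
  interval zero = a , b
  interval (suc n) = halve (interval n)

  lo hi : ℕ → ℚ
  lo n = proj₁ (interval n)
  hi n = proj₂ (interval n)

  record Bracket (n : ℕ) (l h : ℚ) : Set where
    field
      a≤l : a ≤ l
      l≤h : l ≤ h
      h≤b : h ≤ b
      fl<0 : f l < 0ℚ
      0≤fh : 0ℚ ≤ f h
      width : (h - l) * ιℕ (2 ℕ.^ n) ≡ b - a
  open Bracket

  halve-bracket : ∀ {n l h} → Bracket n l h →
    Bracket (suc n) (proj₁ (halve (l , h))) (proj₂ (halve (l , h)))
      × l ≤ proj₁ (halve (l , h)) × proj₂ (halve (l , h)) ≤ h
  halve-bracket {n} {l} {h} br with f (midpoint l h) ℚP.<? 0ℚ
  ... | yes fm<0 = record
    { a≤l = ℚP.≤-trans (a≤l br) (l≤midpoint (l≤h br)) ; l≤h = midpoint≤h (l≤h br) ; h≤b = h≤b br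
    ; fl<0 = fm<0 ; 0≤fh = 0≤fh br
    ; width = trans (cong (_* ιℕ (2 ℕ.^ suc n)) (h-midpoint l h)) (trans (half-width l h n) (width br)) }
    , l≤midpoint (l≤h br) , ℚP.≤-refl
  ... | no fm≮0 = record
    { a≤l = a≤l br ; l≤h = l≤midpoint (l≤h br) ; h≤b = ℚP.≤-trans (midpoint≤h (l≤h br)) (h≤b br)
    ; fl<0 = fl<0 br ; 0≤fh = ℚP.≮⇒≥ fm≮0
    ; width = trans (cong (_* ιℕ (2 ℕ.^ suc n)) (midpoint-l l h)) (trans (half-width l h n) (width br)) }
    , ℚP.≤-refl , midpoint≤h (l≤h br)

  module Root (a≤b : a ≤ b) (fa<0 : f a < 0ℚ) (0<fb : 0ℚ < f b) (L : ℕ) (lip : LipschitzOn f a b L) where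

    bracket : ∀ n → Bracket n (lo n) (hi n)
    bracket zero = record
      { a≤l = ℚP.≤-refl ; l≤h = a≤b ; h≤b = ℚP.≤-refl ; fl<0 = fa<0 ; 0≤fh = ℚP.<⇒≤ 0<fb
      ; width = ℚP.*-identityʳ (b - a) }
    bracket (suc n) = proj₁ (halve-bracket (bracket n))

    lo-mono : ∀ {m n} → m ℕ.≤′ n → lo m ≤ lo n
    lo-mono ℕ.≤′-refl = ℚP.≤-refl
    lo-mono (ℕ.≤′-step {n} m≤′n) = ℚP.≤-trans (lo-mono m≤′n) (proj₁ (proj₂ (halve-bracket (bracket n))))

    hi-antimono : ∀ {m n} → m ℕ.≤′ n → hi n ≤ hi m
    hi-antimono ℕ.≤′-refl = ℚP.≤-refl
    hi-antimono (ℕ.≤′-step {n} m≤′n) = ℚP.≤-trans (proj₂ (proj₂ (halve-bracket (bracket n)))) (hi-antimono m≤′n)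

    L′ : ℚ
    L′ = ιℕ (suc L)

    -- b − a ≤ 2^C, so after k + C halvings the bracket is at most 1/(k+1) wide; x k is its upper end.
    C : ℕ
    C = proj₁ (ℚ≤ιℕ (b - a))

    b-a≤2^C : b - a ≤ ιℕ (2 ℕ.^ C)
    b-a≤2^C = ℚP.≤-trans (proj₂ (ℚ≤ιℕ (b - a))) (ιℕ-mono-≤ (ℕP.<⇒≤ (n<2^n C)))

    width-bound : ∀ k → hi (k ℕ.+ C) - lo (k ℕ.+ C) ≤ recip k
    width-bound k = *-cancelˡ-≤ (ιℕ-pos (suc k)) (begin
      ιℕ (suc k) * w                 ≤⟨ *-monoʳ-≤ (p≤q⇒0≤q-p (l≤h br)) (ιℕ-mono-≤ (n<2^n k)) ⟩
      ιℕ (2 ℕ.^ k) * w               ≡⟨ ℚP.*-comm (ιℕ (2 ℕ.^ k)) w ⟩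
      w * ιℕ (2 ℕ.^ k)               ≤⟨ w2^k≤1 ⟩
      1ℚ                             ≡⟨ ιℕ*recip k ⟨
      ιℕ (suc k) * recip k           ∎)
      where
      open ℚP.≤-Reasoning
      br = bracket (k ℕ.+ C)
      w = hi (k ℕ.+ C) - lo (k ℕ.+ C)
      instance
        2^C≢0 : ℕ.NonZero (2 ℕ.^ C)
        2^C≢0 = ℕP.m^n≢0 2 C
      w2^k≤1 : w * ιℕ (2 ℕ.^ k) ≤ 1ℚ
      w2^k≤1 = *-cancelˡ-≤ (ιℕ-pos (2 ℕ.^ C)) (begin
        ιℕ (2 ℕ.^ C) * (w * ιℕ (2 ℕ.^ k))      ≡⟨ regroup (ιℕ (2 ℕ.^ C)) w (ιℕ (2 ℕ.^ k)) ⟩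
        w * (ιℕ (2 ℕ.^ k) * ιℕ (2 ℕ.^ C))      ≡⟨ cong (w *_) (ιℕ-homo-* (2 ℕ.^ k) (2 ℕ.^ C)) ⟨
        w * ιℕ (2 ℕ.^ k ℕ.* 2 ℕ.^ C)           ≡⟨ cong (λ e → w * ιℕ e) (ℕP.^-distribˡ-+-* 2 k C) ⟨
        w * ιℕ (2 ℕ.^ (k ℕ.+ C))               ≡⟨ width br ⟩
        b - a                                  ≤⟨ b-a≤2^C ⟩
        ιℕ (2 ℕ.^ C)                           ≡⟨ ℚP.*-identityʳ _ ⟨
        ιℕ (2 ℕ.^ C) * 1ℚ                      ∎)
        where
        regroup : ∀ x y z → x * (y * z) ≡ y * (z * x)
        regroup = solve-∀ ℚ-ring

    x : ℕ → ℚ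
    x k = hi (k ℕ.+ C)

    a≤x : ∀ k → a ≤ x k
    a≤x k = ℚP.≤-trans (a≤l (bracket (k ℕ.+ C))) (l≤h (bracket (k ℕ.+ C)))

    x≤b : ∀ k → x k ≤ b
    x≤b k = h≤b (bracket (k ℕ.+ C))

    ∣xₘ-xₙ∣≤recip : ∀ {m n} → m ℕ.≤ n → ℚ.∣ x m - x n ∣ ≤ recip m
    ∣xₘ-xₙ∣≤recip {m} {n} m≤n = begin
      ℚ.∣ x m - x n ∣                        ≡⟨ ℚP.0≤p⇒∣p∣≡p (p≤q⇒0≤q-p xn≤xm) ⟩
      x m - x n                              ≤⟨ ℚP.+-monoʳ-≤ (x m) (ℚP.neg-antimono-≤ lo≤xn) ⟩
      hi (m ℕ.+ C) - lo (m ℕ.+ C)            ≤⟨ width-bound m ⟩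
      recip m                                ∎
      where
      open ℚP.≤-Reasoning
      m+C≤n+C = ℕP.≤⇒≤′ (ℕP.+-monoˡ-≤ C m≤n)
      xn≤xm : x n ≤ x m
      xn≤xm = hi-antimono m+C≤n+C
      lo≤xn : lo (m ℕ.+ C) ≤ x n
      lo≤xn = ℚP.≤-trans (lo-mono m+C≤n+C) (l≤h (bracket (n ℕ.+ C)))

    regular : IsRegular x
    regular m n with ℕP.≤-total m n
    ... | inj₁ m≤n = ℚP.≤-trans (∣xₘ-xₙ∣≤recip m≤n) (p≤p+q (ℚP.<⇒≤ (recip-pos n)))
    ... | inj₂ n≤m = ℚP.≤-trans (ℚP.≤-reflexive (∣p-q∣≡∣q-p∣ (x m) (x n)))
                       (ℚP.≤-trans (∣xₘ-xₙ∣≤recip n≤m) (p≤q+p (ℚP.<⇒≤ (recip-pos m))))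

    fx≤L′recip : ∀ k → f (x k) ≤ L′ * recip k
    fx≤L′recip k = begin
      f (hi n)                  ≤⟨ p≤p+q (ℚP.<⇒≤ (ℚP.neg-antimono-< (fl<0 br))) ⟩
      f (hi n) - f (lo n)       ≤⟨ lip (lo n) (hi n) (a≤l br) (l≤h br) (h≤b br) ⟩
      L′ * (hi n - lo n)        ≤⟨ *-monoˡ-≤ (ιℕ-nonNeg (suc L)) (width-bound k) ⟩
      L′ * recip k              ∎
      where
      open ℚP.≤-Reasoning
      n = k ℕ.+ C
      br = bracket n

    zero-at : ZeroAt f x
    zero-at j = N , λ n N≤n → begin
      ℚ.∣ f (x n) ∣  ≡⟨ ℚP.0≤p⇒∣p∣≡p (0≤fh (bracket (n ℕ.+ C))) ⟩
      f (x n)        ≤⟨ fx≤L′recip n ⟩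
      L′ * recip n   <⟨ small n N≤n ⟩
      recip j        ∎
      where
      open ℚP.≤-Reasoning
      N = proj₁ (*recip-eventually< (suc L) (recip j) (recip-pos j))
      small = proj₂ (*recip-eventually< (suc L) (recip j) (recip-pos j))

    above-a : a <ᴿ x
    above-a = N , r<q-p⇒p<q-r {a} {x N} (*-cancelˡ-< (ιℕ-nonNeg (suc L)) (begin-strict
      L′ * recip N          <⟨ proj₂ (*recip-eventually< (suc L) (- f a) -fa>0) N ℕP.≤-refl ⟩
      - f a                 ≤⟨ p≤q+p { - f a} (0≤fh (bracket (N ℕ.+ C))) ⟩
      f (x N) - f a         ≤⟨ lip a (x N) ℚP.≤-refl (a≤x N) (x≤b N) ⟩
      L′ * (x N - a)        ∎))
      where
      open ℚP.≤-Reasoning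
      -fa>0 = ℚP.neg-antimono-< fa<0
      N = proj₁ (*recip-eventually< (suc L) (- f a) -fa>0)

    below-b : x <ᴸ b
    below-b = N , r<q-p⇒p+r<q {x N} {b} (*-cancelˡ-< (ιℕ-nonNeg (suc L)) (+-cancelʳ-< (L′ * r) (begin-strict
      L′ * r + L′ * r              ≡⟨ double ⟩
      ιℕ (suc L ℕ.+ suc L) * r     <⟨ proj₂ (*recip-eventually< (suc L ℕ.+ suc L) (f b) 0<fb) N ℕP.≤-refl ⟩
      f b                          ≡⟨ q-p+p≡q (f (x N)) (f b) ⟨
      f b - f (x N) + f (x N)      ≤⟨ ℚP.+-mono-≤ (lip (x N) b (a≤x N) (x≤b N) ℚP.≤-refl) (fx≤L′recip N) ⟩
      L′ * (b - x N) + L′ * r      ∎)))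
      where
      open ℚP.≤-Reasoning
      N = proj₁ (*recip-eventually< (suc L ℕ.+ suc L) (f b) 0<fb)
      r = recip N
      double : L′ * r + L′ * r ≡ ιℕ (suc L ℕ.+ suc L) * r
      double = trans (distrib L′ r) (cong (_* r) (sym (ιℕ-homo-+ (suc L) (suc L))))
        where
        distrib : ∀ l r → l * r + l * r ≡ (l + l) * r
        distrib = solve-∀ ℚ-ring

bisection-root : ∀ f a b L → a ≤ b → f a < 0ℚ → 0ℚ < f b → LipschitzOn f a b L → HasRealRootIn f a b
bisection-root f a b L a≤b fa<0 0<fb lip = x , regular , above-a , below-b , zero-at
  where open Bisection.Root f a b a≤b fa<0 0<fb L lip

-- Polynomials in Horner form

horner : List ℚ → ℚ → ℚ
horner [] x = 0ℚ
horner (c ∷ cs) x = c + x * horner cs x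

hornerBound : List ℚ → ℚ → ℚ
hornerBound [] M = 0ℚ
hornerBound (c ∷ cs) M = ℚ.∣ c ∣ + M * hornerBound cs M

hornerLipschitz : List ℚ → ℚ → ℚ
hornerLipschitz [] M = 0ℚ
hornerLipschitz (c ∷ cs) M = hornerBound cs M + M * hornerLipschitz cs M

∣-∣-nonNeg : ∀ p → 0ℚ ≤ ℚ.∣ p ∣
∣-∣-nonNeg p = ℚP.nonNegative⁻¹ ℚ.∣ p ∣ {{ℚP.∣-∣-nonNeg p}}

p≤∣p∣ : ∀ p → p ≤ ℚ.∣ p ∣
p≤∣p∣ p with 0ℚ ℚP.≤? p
... | yes 0≤p = ℚP.≤-reflexive (sym (ℚP.0≤p⇒∣p∣≡p 0≤p))
... | no 0≰p = ℚP.≤-trans (ℚP.<⇒≤ (ℚP.≰⇒> 0≰p)) (∣-∣-nonNeg p)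

∣∣-between : ∀ {a b x} → a ≤ x → x ≤ b → ℚ.∣ x ∣ ≤ ℚ.∣ a ∣ + ℚ.∣ b ∣
∣∣-between {a} {b} {x} a≤x x≤b with ℚP.∣p∣≡p∨∣p∣≡-p x
... | inj₁ ∣x∣≡x = begin
  ℚ.∣ x ∣                ≡⟨ ∣x∣≡x ⟩
  x                      ≤⟨ ℚP.≤-trans x≤b (p≤∣p∣ b) ⟩
  ℚ.∣ b ∣                ≤⟨ p≤q+p (∣-∣-nonNeg a) ⟩
  ℚ.∣ a ∣ + ℚ.∣ b ∣      ∎
  where open ℚP.≤-Reasoning
... | inj₂ ∣x∣≡-x = begin
  ℚ.∣ x ∣                ≡⟨ ∣x∣≡-x ⟩
  - x                    ≤⟨ ℚP.neg-antimono-≤ a≤x ⟩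
  - a                    ≤⟨ subst (- a ≤_) (ℚP.∣-p∣≡∣p∣ a) (p≤∣p∣ (- a)) ⟩
  ℚ.∣ a ∣                ≤⟨ p≤p+q (∣-∣-nonNeg b) ⟩
  ℚ.∣ a ∣ + ℚ.∣ b ∣      ∎
  where open ℚP.≤-Reasoning

∣*∣-mono-≤ : ∀ {x y A B} → ℚ.∣ x ∣ ≤ A → ℚ.∣ y ∣ ≤ B → ℚ.∣ x * y ∣ ≤ A * B
∣*∣-mono-≤ {x} {y} {A} {B} ∣x∣≤A ∣y∣≤B = begin
  ℚ.∣ x * y ∣          ≡⟨ ℚP.∣p*q∣≡∣p∣*∣q∣ x y ⟩
  ℚ.∣ x ∣ * ℚ.∣ y ∣    ≤⟨ *-monoʳ-≤ (∣-∣-nonNeg y) ∣x∣≤A ⟩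
  A * ℚ.∣ y ∣          ≤⟨ *-monoˡ-≤ (ℚP.≤-trans (∣-∣-nonNeg x) ∣x∣≤A) ∣y∣≤B ⟩
  A * B                ∎
  where open ℚP.≤-Reasoning

∣horner∣≤ : ∀ cs {M x} → ℚ.∣ x ∣ ≤ M → ℚ.∣ horner cs x ∣ ≤ hornerBound cs M
∣horner∣≤ [] _ = ℚP.≤-refl
∣horner∣≤ (c ∷ cs) {M} {x} ∣x∣≤M = ℚP.≤-trans (ℚP.∣p+q∣≤∣p∣+∣q∣ c (x * horner cs x))
  (ℚP.+-monoʳ-≤ ℚ.∣ c ∣ (∣*∣-mono-≤ ∣x∣≤M (∣horner∣≤ cs ∣x∣≤M)))

horner-lipschitz : ∀ cs {M x y} → ℚ.∣ x ∣ ≤ M → ℚ.∣ y ∣ ≤ M →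
  ℚ.∣ horner cs x - horner cs y ∣ ≤ hornerLipschitz cs M * ℚ.∣ x - y ∣
horner-lipschitz [] {x = x} {y} _ _ = ℚP.≤-reflexive (sym (ℚP.*-zeroˡ ℚ.∣ x - y ∣))
horner-lipschitz (c ∷ cs) {M} {x} {y} ∣x∣≤M ∣y∣≤M = begin
  ℚ.∣ (c + x * hx) - (c + y * hy) ∣                  ≡⟨ cong ℚ.∣_∣ (split c x y hx hy) ⟩
  ℚ.∣ (x - y) * hx + y * (hx - hy) ∣                 ≤⟨ ℚP.∣p+q∣≤∣p∣+∣q∣ ((x - y) * hx) (y * (hx - hy)) ⟩
  ℚ.∣ (x - y) * hx ∣ + ℚ.∣ y * (hx - hy) ∣           ≤⟨ ℚP.+-mono-≤ (∣*∣-mono-≤ {x - y} ℚP.≤-refl (∣horner∣≤ cs ∣x∣≤M))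
                                                          (∣*∣-mono-≤ {y} ∣y∣≤M (horner-lipschitz cs ∣x∣≤M ∣y∣≤M)) ⟩
  ℚ.∣ x - y ∣ * B + M * (Lip * ℚ.∣ x - y ∣)         ≡⟨ collect ℚ.∣ x - y ∣ B M Lip ⟩
  (B + M * Lip) * ℚ.∣ x - y ∣                        ∎
  where
  open ℚP.≤-Reasoning
  hx = horner cs x
  hy = horner cs y
  B = hornerBound cs M
  Lip = hornerLipschitz cs M
  split : ∀ c x y hx hy → (c + x * hx) - (c + y * hy) ≡ (x - y) * hx + y * (hx - hy)
  split = solve-∀ ℚ-ring
  collect : ∀ d B M L → d * B + M * (L * d) ≡ (B + M * L) * d
  collect = solve-∀ ℚ-ring

horner-lipschitzOn : ∀ cs a b → ∃ λ L → LipschitzOn (horner cs) a b L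
horner-lipschitzOn cs a b = L , λ x y a≤x x≤y y≤b → begin
  horner cs y - horner cs x                   ≤⟨ p≤∣p∣ _ ⟩
  ℚ.∣ horner cs y - horner cs x ∣             ≤⟨ horner-lipschitz cs (∣∣-between (ℚP.≤-trans a≤x x≤y) y≤b)
                                                                     (∣∣-between a≤x (ℚP.≤-trans x≤y y≤b)) ⟩
  Lip * ℚ.∣ y - x ∣                           ≡⟨ cong (Lip *_) (ℚP.0≤p⇒∣p∣≡p (p≤q⇒0≤q-p x≤y)) ⟩
  Lip * (y - x)                               ≤⟨ *-monoʳ-≤ (p≤q⇒0≤q-p x≤y) Lip≤L′ ⟩
  ιℕ (suc L) * (y - x)                        ∎
  where
  open ℚP.≤-Reasoning
  Lip = hornerLipschitz cs (ℚ.∣ a ∣ + ℚ.∣ b ∣)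
  L = proj₁ (ℚ≤ιℕ Lip)
  Lip≤L′ : Lip ≤ ιℕ (suc L)
  Lip≤L′ = ℚP.≤-trans (proj₂ (ℚ≤ιℕ Lip)) (ℚP.<⇒≤ (ιℕ<ιℕ-suc L))

root-cong : ∀ {f g a b} → (∀ t → f t ≡ g t) → HasRealRootIn f a b → HasRealRootIn g a b
root-cong {f} {g} f≗g (x , regular , above , below , zero-at) =
  x , regular , above , below , λ k → map₂ (λ bound n N≤n → subst (λ v → ℚ.∣ v ∣ ≤ recip k) (f≗g (x n)) (bound n N≤n)) (zero-at k)

polynomial-root : ∀ f cs {a b} → (∀ t → f t ≡ horner cs t) →
  a ≤ b → f a < 0ℚ → 0ℚ < f b → HasRealRootIn f a b
polynomial-root f cs {a} {b} f≗p a≤b fa<0 0<fb = root-cong (λ t → sym (f≗p t))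
  (bisection-root (horner cs) a b L a≤b (subst (_< 0ℚ) (f≗p a) fa<0) (subst (0ℚ <_) (f≗p b) 0<fb) lip)
  where
  L = proj₁ (horner-lipschitzOn cs a b)
  lip = proj₂ (horner-lipschitzOn cs a b)

-- Normalising polynomial expressions

infixl 6 _⊕_ _⊖_
infixl 7 _⊗_
infixr 8 _⊛_
infix 9 ⊝_

data Expr (n : ℕ) : Set where
  var : Fin n → Expr n
  con : ℤ → Expr n
  _⊕_ _⊗_ _⊖_ : Expr n → Expr n → Expr n
  ⊝_ : Expr n → Expr n
  _⊛_ : Expr n → ℕ → Expr n

⟦_⟧ : ∀ {n} → Expr n → Vec ℚ n → ℚ
⟦ var i ⟧ ρ = lookup ρ i
⟦ con z ⟧ ρ = ι z
⟦ e ⊕ e′ ⟧ ρ = ⟦ e ⟧ ρ + ⟦ e′ ⟧ ρ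
⟦ e ⊗ e′ ⟧ ρ = ⟦ e ⟧ ρ * ⟦ e′ ⟧ ρ
⟦ e ⊖ e′ ⟧ ρ = ⟦ e ⟧ ρ - ⟦ e′ ⟧ ρ
⟦ ⊝ e ⟧ ρ = - ⟦ e ⟧ ρ
⟦ e ⊛ k ⟧ ρ = ⟦ e ⟧ ρ ^ k

Monomial : ℕ → Set
Monomial n = Vec ℕ n

-- Sparse polynomials: strictly ordered monomials with nonzero coefficients, so that
-- a polynomial expression is zero exactly when it normalises to [].
Poly : ℕ → Set
Poly n = List (ℤ × Monomial n)

data Ordering {n} (m m′ : Monomial n) : Set where
  less greater : Ordering m m′
  equal : m ≡ m′ → Ordering m m′

compare : ∀ {n} (m m′ : Monomial n) → Ordering m m′
compare [] [] = equal refl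
compare (i ∷ m) (j ∷ m′) with i ℕ.≟ j
... | no _ = if i ℕ.<ᵇ j then less else greater
... | yes refl with compare m m′
...   | less = less
...   | greater = greater
...   | equal m≡m′ = equal (cong (i ∷_) m≡m′)

isZero : ℤ → Bool
isZero (+ 0) = true
isZero _ = false

isZero⇒≡0 : ∀ z → isZero z ≡ true → z ≡ + 0
isZero⇒≡0 (+ 0) _ = refl

cons : ∀ {n} → ℤ → Monomial n → Poly n → Poly n
cons z m p = if isZero z then p else (z , m) ∷ p

mutual
  _+ₚ_ : ∀ {n} → Poly n → Poly n → Poly n
  [] +ₚ q = q
  (t ∷ p) +ₚ q = insert t p q

  insert : ∀ {n} → ℤ × Monomial n → Poly n → Poly n → Poly n
  insert t p [] = t ∷ p
  insert (c , m) p ((d , m′) ∷ q) = insertBy c m p d m′ q (compare m m′)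

  insertBy : ∀ {n} → ℤ → (m : Monomial n) → Poly n → ℤ → (m′ : Monomial n) → Poly n → Ordering m m′ → Poly n
  insertBy c m p d m′ q less = (c , m) ∷ (p +ₚ ((d , m′) ∷ q))
  insertBy c m p d m′ q greater = (d , m′) ∷ insert (c , m) p q
  insertBy c m p d m′ q (equal _) = cons (c ℤ.+ d) m (p +ₚ q)

_·ₘ_ : ∀ {n} → Monomial n → Monomial n → Monomial n
[] ·ₘ [] = []
(i ∷ m) ·ₘ (j ∷ m′) = (i ℕ.+ j) ∷ (m ·ₘ m′)

mulTerm : ∀ {n} → ℤ → Monomial n → Poly n → Poly n
mulTerm c m [] = []
mulTerm c m ((d , m′) ∷ p) = (c ℤ.* d , m ·ₘ m′) ∷ mulTerm c m p

_*ₚ_ : ∀ {n} → Poly n → Poly n → Poly n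
[] *ₚ q = []
((c , m) ∷ p) *ₚ q = mulTerm c m q +ₚ (p *ₚ q)

negate : ∀ {n} → Poly n → Poly n
negate [] = []
negate ((c , m) ∷ p) = (ℤ.- c , m) ∷ negate p

1ₘ : ∀ {n} → Monomial n
1ₘ {zero} = []
1ₘ {suc n} = 0 ∷ 1ₘ

varₘ : ∀ {n} → Fin n → Monomial n
varₘ zero = 1 ∷ 1ₘ
varₘ (suc i) = 0 ∷ varₘ i

_^ₚ_ : ∀ {n} → Poly n → ℕ → Poly n
p ^ₚ zero = (+ 1 , 1ₘ) ∷ []
p ^ₚ suc k = p *ₚ (p ^ₚ k)

normalise : ∀ {n} → Expr n → Poly n
normalise (var i) = (+ 1 , varₘ i) ∷ []
normalise (con z) = cons z 1ₘ []
normalise (e ⊕ e′) = normalise e +ₚ normalise e′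
normalise (e ⊗ e′) = normalise e *ₚ normalise e′
normalise (e ⊖ e′) = normalise e +ₚ negate (normalise e′)
normalise (⊝ e) = negate (normalise e)
normalise (e ⊛ k) = normalise e ^ₚ k

⟦_⟧ₘ : ∀ {n} → Monomial n → Vec ℚ n → ℚ
⟦ [] ⟧ₘ [] = 1ℚ
⟦ i ∷ m ⟧ₘ (x ∷ ρ) = x ^ i * ⟦ m ⟧ₘ ρ

⟦_⟧ₚ : ∀ {n} → Poly n → Vec ℚ n → ℚ
⟦ [] ⟧ₚ ρ = 0ℚ
⟦ (c , m) ∷ p ⟧ₚ ρ = ι c * ⟦ m ⟧ₘ ρ + ⟦ p ⟧ₚ ρ

·ₘ-homo : ∀ {n} (m m′ : Monomial n) ρ → ⟦ m ·ₘ m′ ⟧ₘ ρ ≡ ⟦ m ⟧ₘ ρ * ⟦ m′ ⟧ₘ ρ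
·ₘ-homo [] [] [] = sym (ℚP.*-identityˡ 1ℚ)
·ₘ-homo (i ∷ m) (j ∷ m′) (x ∷ ρ) =
  trans (cong₂ _*_ (^-+ x i j) (·ₘ-homo m m′ ρ)) (interchange (x ^ i) (x ^ j) (⟦ m ⟧ₘ ρ) (⟦ m′ ⟧ₘ ρ))
  where
  interchange : ∀ a b c d → (a * b) * (c * d) ≡ (a * c) * (b * d)
  interchange = solve-∀ ℚ-ring

1ₘ-homo : ∀ {n} (ρ : Vec ℚ n) → ⟦ 1ₘ ⟧ₘ ρ ≡ 1ℚ
1ₘ-homo [] = refl
1ₘ-homo (x ∷ ρ) = trans (ℚP.*-identityˡ _) (1ₘ-homo ρ)

varₘ-homo : ∀ {n} (i : Fin n) ρ → ⟦ varₘ i ⟧ₘ ρ ≡ lookup ρ i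
varₘ-homo zero (x ∷ ρ) = trans (cong (x ^ 1 *_) (1ₘ-homo ρ)) (trans (ℚP.*-identityʳ (x ^ 1)) (ℚP.*-identityʳ x))
varₘ-homo (suc i) (x ∷ ρ) = trans (ℚP.*-identityˡ _) (varₘ-homo i ρ)

cons-homo : ∀ {n} z (m : Monomial n) p ρ → ⟦ cons z m p ⟧ₚ ρ ≡ ι z * ⟦ m ⟧ₘ ρ + ⟦ p ⟧ₚ ρ
cons-homo z m p ρ with isZero z in z≟0
... | false = refl
... | true rewrite isZero⇒≡0 z z≟0 =
  sym (trans (cong (_+ ⟦ p ⟧ₚ ρ) (ℚP.*-zeroˡ (⟦ m ⟧ₘ ρ))) (ℚP.+-identityˡ (⟦ p ⟧ₚ ρ)))

mutual
  +ₚ-homo : ∀ {n} (p q : Poly n) ρ → ⟦ p +ₚ q ⟧ₚ ρ ≡ ⟦ p ⟧ₚ ρ + ⟦ q ⟧ₚ ρ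
  +ₚ-homo [] q ρ = sym (ℚP.+-identityˡ _)
  +ₚ-homo (t ∷ p) q ρ = insert-homo t p q ρ

  insert-homo : ∀ {n} t (p q : Poly n) ρ → ⟦ insert t p q ⟧ₚ ρ ≡ ⟦ t ∷ p ⟧ₚ ρ + ⟦ q ⟧ₚ ρ
  insert-homo t p [] ρ = sym (ℚP.+-identityʳ _)
  insert-homo (c , m) p ((d , m′) ∷ q) ρ = insertBy-homo c m p d m′ q (compare m m′) ρ

  insertBy-homo : ∀ {n} c (m : Monomial n) p d m′ q (o : Ordering m m′) ρ →
    ⟦ insertBy c m p d m′ q o ⟧ₚ ρ ≡ ⟦ (c , m) ∷ p ⟧ₚ ρ + ⟦ (d , m′) ∷ q ⟧ₚ ρ
  insertBy-homo c m p d m′ q less ρ =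
    trans (cong (_+_ (ι c * ⟦ m ⟧ₘ ρ)) (+ₚ-homo p ((d , m′) ∷ q) ρ))
      (sym (ℚP.+-assoc (ι c * ⟦ m ⟧ₘ ρ) (⟦ p ⟧ₚ ρ) (⟦ (d , m′) ∷ q ⟧ₚ ρ)))
  insertBy-homo c m p d m′ q greater ρ =
    trans (cong (_+_ (ι d * ⟦ m′ ⟧ₘ ρ)) (insert-homo (c , m) p q ρ))
      (shuffle (ι c * ⟦ m ⟧ₘ ρ) (⟦ p ⟧ₚ ρ) (ι d * ⟦ m′ ⟧ₘ ρ) (⟦ q ⟧ₚ ρ))
    where
    shuffle : ∀ a b c d → c + ((a + b) + d) ≡ (a + b) + (c + d)
    shuffle = solve-∀ ℚ-ring
  insertBy-homo c m p d .m q (equal refl) ρ =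
    trans (cons-homo (c ℤ.+ d) m (p +ₚ q) ρ)
      (trans (cong₂ (λ a b → a * ⟦ m ⟧ₘ ρ + b) (ι-homo-+ c d) (+ₚ-homo p q ρ))
        (collect (ι c) (ι d) (⟦ m ⟧ₘ ρ) (⟦ p ⟧ₚ ρ) (⟦ q ⟧ₚ ρ)))
    where
    collect : ∀ a b x u v → (a + b) * x + (u + v) ≡ (a * x + u) + (b * x + v)
    collect = solve-∀ ℚ-ring

mulTerm-homo : ∀ {n} c (m : Monomial n) p ρ → ⟦ mulTerm c m p ⟧ₚ ρ ≡ (ι c * ⟦ m ⟧ₘ ρ) * ⟦ p ⟧ₚ ρ
mulTerm-homo c m [] ρ = sym (ℚP.*-zeroʳ (ι c * ⟦ m ⟧ₘ ρ))
mulTerm-homo c m ((d , m′) ∷ p) ρ =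
  trans (cong₂ (λ a b → a * ⟦ m ·ₘ m′ ⟧ₘ ρ + b) (ι-homo-* c d) (mulTerm-homo c m p ρ))
    (trans (cong (λ a → ι c * ι d * a + ι c * ⟦ m ⟧ₘ ρ * ⟦ p ⟧ₚ ρ) (·ₘ-homo m m′ ρ))
      (distrib (ι c) (ι d) (⟦ m ⟧ₘ ρ) (⟦ m′ ⟧ₘ ρ) (⟦ p ⟧ₚ ρ)))
  where
  distrib : ∀ c d x y r → c * d * (x * y) + c * x * r ≡ c * x * (d * y + r)
  distrib = solve-∀ ℚ-ring

*ₚ-homo : ∀ {n} (p q : Poly n) ρ → ⟦ p *ₚ q ⟧ₚ ρ ≡ ⟦ p ⟧ₚ ρ * ⟦ q ⟧ₚ ρ
*ₚ-homo [] q ρ = sym (ℚP.*-zeroˡ (⟦ q ⟧ₚ ρ))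
*ₚ-homo ((c , m) ∷ p) q ρ =
  trans (+ₚ-homo (mulTerm c m q) (p *ₚ q) ρ)
    (trans (cong₂ _+_ (mulTerm-homo c m q ρ) (*ₚ-homo p q ρ)) (sym (ℚP.*-distribʳ-+ (⟦ q ⟧ₚ ρ) (ι c * ⟦ m ⟧ₘ ρ) (⟦ p ⟧ₚ ρ))))

negate-homo : ∀ {n} (p : Poly n) ρ → ⟦ negate p ⟧ₚ ρ ≡ - ⟦ p ⟧ₚ ρ
negate-homo [] ρ = refl
negate-homo ((c , m) ∷ p) ρ =
  trans (cong₂ (λ a b → a * ⟦ m ⟧ₘ ρ + b) (ι-homo‿- c) (negate-homo p ρ)) (neg-out (ι c) (⟦ m ⟧ₘ ρ) (⟦ p ⟧ₚ ρ))
  where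
  neg-out : ∀ a x r → - a * x + - r ≡ - (a * x + r)
  neg-out = solve-∀ ℚ-ring

^ₚ-homo : ∀ {n} (p : Poly n) k ρ → ⟦ p ^ₚ k ⟧ₚ ρ ≡ ⟦ p ⟧ₚ ρ ^ k
^ₚ-homo p zero ρ = cong (λ a → 1ℚ * a + 0ℚ) (1ₘ-homo ρ)
^ₚ-homo p (suc k) ρ = trans (*ₚ-homo p (p ^ₚ k) ρ) (cong (⟦ p ⟧ₚ ρ *_) (^ₚ-homo p k ρ))

normalise-sound : ∀ {n} (e : Expr n) ρ → ⟦ normalise e ⟧ₚ ρ ≡ ⟦ e ⟧ ρ
normalise-sound (var i) ρ = trans (ℚP.+-identityʳ _) (trans (ℚP.*-identityˡ _) (varₘ-homo i ρ))
normalise-sound (con z) ρ =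
  trans (cons-homo z 1ₘ [] ρ) (trans (ℚP.+-identityʳ _) (trans (cong (ι z *_) (1ₘ-homo ρ)) (ℚP.*-identityʳ (ι z))))
normalise-sound (e ⊕ e′) ρ = trans (+ₚ-homo (normalise e) (normalise e′) ρ) (cong₂ _+_ (normalise-sound e ρ) (normalise-sound e′ ρ))
normalise-sound (e ⊗ e′) ρ = trans (*ₚ-homo (normalise e) (normalise e′) ρ) (cong₂ _*_ (normalise-sound e ρ) (normalise-sound e′ ρ))
normalise-sound (e ⊖ e′) ρ = trans (+ₚ-homo (normalise e) (negate (normalise e′)) ρ)
  (cong₂ _+_ (normalise-sound e ρ) (trans (negate-homo (normalise e′) ρ) (cong -_ (normalise-sound e′ ρ))))
normalise-sound (⊝ e) ρ = trans (negate-homo (normalise e) ρ) (cong -_ (normalise-sound e ρ))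
normalise-sound (e ⊛ k) ρ = trans (^ₚ-homo (normalise e) k ρ) (cong (_^ k) (normalise-sound e ρ))

≡-by-normalise : ∀ {n} (e e′ : Expr n) → normalise (e ⊖ e′) ≡ [] → ∀ ρ → ⟦ e ⟧ ρ ≡ ⟦ e′ ⟧ ρ
≡-by-normalise e e′ e-e′≡0 ρ = begin
  ⟦ e ⟧ ρ                        ≡⟨ q-p+p≡q (⟦ e′ ⟧ ρ) (⟦ e ⟧ ρ) ⟨
  ⟦ e ⊖ e′ ⟧ ρ + ⟦ e′ ⟧ ρ        ≡⟨ cong (_+ ⟦ e′ ⟧ ρ) (normalise-sound (e ⊖ e′) ρ) ⟨
  ⟦ normalise (e ⊖ e′) ⟧ₚ ρ + ⟦ e′ ⟧ ρ  ≡⟨ cong (λ p → ⟦ p ⟧ₚ ρ + ⟦ e′ ⟧ ρ) e-e′≡0 ⟩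
  0ℚ + ⟦ e′ ⟧ ρ                  ≡⟨ ℚP.+-identityˡ _ ⟩
  ⟦ e′ ⟧ ρ                       ∎
  where open ≡-Reasoning

-- Dominance of a leading monomial

module Dominance (u v : ℕ) {P c k : ℚ} (0≤P : 0ℚ ≤ P) (0≤c : 0ℚ ≤ c) (0≤k : 0ℚ ≤ k)
                 (c²-trade : ιℕ u * (c * c) ≤ P * k) (k-trade : ιℕ v * k ≤ P) where

  monomial : ℕ → ℕ → ℕ → ℚ
  monomial α β γ = ⟦ α ∷ β ∷ γ ∷ [] ⟧ₘ (P ∷ c ∷ k ∷ [])

  monomial-nonNeg : ∀ α β γ → 0ℚ ≤ monomial α β γ
  monomial-nonNeg α β γ = *-nonNeg (^-nonNeg α 0≤P) (*-nonNeg (^-nonNeg β 0≤c) (*-nonNeg (^-nonNeg γ 0≤k) (ℚP.nonNegative⁻¹ 1ℚ)))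

  trade-c² : ∀ α β γ → ιℕ u * monomial α (2 ℕ.+ β) γ ≤ monomial (suc α) β (suc γ)
  trade-c² α β γ = begin
    ιℕ u * (P ^ α * (c * (c * c ^ β) * (k ^ γ * 1ℚ)))    ≡⟨ extract (ιℕ u) (P ^ α) c (c ^ β) (k ^ γ) ⟩
    monomial α β γ * (ιℕ u * (c * c))                    ≤⟨ *-monoˡ-≤ (monomial-nonNeg α β γ) c²-trade ⟩
    monomial α β γ * (P * k)                             ≡⟨ absorb P (P ^ α) (c ^ β) k (k ^ γ) ⟩
    P * P ^ α * (c ^ β * (k * k ^ γ * 1ℚ))               ∎
    where
    open ℚP.≤-Reasoning
    extract : ∀ u Pα c cβ kγ → u * (Pα * (c * (c * cβ) * (kγ * 1ℚ))) ≡ Pα * (cβ * (kγ * 1ℚ)) * (u * (c * c))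
    extract = solve-∀ ℚ-ring
    absorb : ∀ P Pα cβ k kγ → Pα * (cβ * (kγ * 1ℚ)) * (P * k) ≡ P * Pα * (cβ * (k * kγ * 1ℚ))
    absorb = solve-∀ ℚ-ring

  trade-k : ∀ α β γ → ιℕ v * monomial α β (suc γ) ≤ monomial (suc α) β γ
  trade-k α β γ = begin
    ιℕ v * (P ^ α * (c ^ β * (k * k ^ γ * 1ℚ)))    ≡⟨ extract (ιℕ v) (P ^ α) (c ^ β) k (k ^ γ) ⟩
    monomial α β γ * (ιℕ v * k)                    ≤⟨ *-monoˡ-≤ (monomial-nonNeg α β γ) k-trade ⟩
    monomial α β γ * P                             ≡⟨ ℚP.*-comm (monomial α β γ) P ⟩
    P * monomial α β γ                             ≡⟨ ℚP.*-assoc P (P ^ α) _ ⟨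
    P * P ^ α * (c ^ β * (k ^ γ * 1ℚ))             ∎
    where
    open ℚP.≤-Reasoning
    extract : ∀ v Pα cβ k kγ → v * (Pα * (cβ * (k * kγ * 1ℚ))) ≡ Pα * (cβ * (kγ * 1ℚ)) * (v * k)
    extract = solve-∀ ℚ-ring

  dominated : ∀ {D m g} a b {α γ} → α ℕ.+ a ℕ.+ b ≡ D → γ ℕ.+ a ≡ g ℕ.+ b →
    ιℕ u ^ a * (ιℕ v ^ b * monomial α (a ℕ.* 2 ℕ.+ m) γ) ≤ monomial D m g
  dominated {D} {m} {g} zero zero {α} {γ} e₁ e₂ = ℚP.≤-reflexive (begin
    1ℚ * (1ℚ * monomial α m γ)   ≡⟨ ℚP.*-identityˡ _ ⟩
    1ℚ * monomial α m γ          ≡⟨ ℚP.*-identityˡ _ ⟩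
    monomial α m γ               ≡⟨ cong₂ (λ D g → monomial D m g) α≡D γ≡g ⟩
    monomial D m g               ∎)
    where
    open ≡-Reasoning
    α≡D : α ≡ D
    α≡D = trans (sym (trans (ℕP.+-identityʳ (α ℕ.+ 0)) (ℕP.+-identityʳ α))) e₁
    γ≡g : γ ≡ g
    γ≡g = trans (sym (ℕP.+-identityʳ γ)) (trans e₂ (ℕP.+-identityʳ g))
  dominated {D} {m} {g} zero (suc b) {α} {γ} e₁ e₂ with trans (sym (ℕP.+-identityʳ γ)) (trans e₂ (ℕP.+-suc g b))
  ... | refl = begin
    1ℚ * (ιℕ v * ιℕ v ^ b * monomial α m (suc (g ℕ.+ b)))   ≡⟨ cong (1ℚ *_) (ℚP.*-assoc (ιℕ v) (ιℕ v ^ b) _) ⟩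
    1ℚ * (ιℕ v * (ιℕ v ^ b * monomial α m (suc (g ℕ.+ b)))) ≡⟨ cong (1ℚ *_) (swap (ιℕ v) (ιℕ v ^ b) _) ⟩
    1ℚ * (ιℕ v ^ b * (ιℕ v * monomial α m (suc (g ℕ.+ b)))) ≤⟨ *-monoˡ-≤ (ℚP.nonNegative⁻¹ 1ℚ)
                                                                  (*-monoˡ-≤ (^-nonNeg b (ιℕ-nonNeg v)) (trade-k α m (g ℕ.+ b))) ⟩
    1ℚ * (ιℕ v ^ b * monomial (suc α) m (g ℕ.+ b))          ≤⟨ dominated {D} {m} {g} zero b (trans (sym (ℕP.+-suc (α ℕ.+ 0) b)) e₁)
                                                                                   (ℕP.+-identityʳ (g ℕ.+ b)) ⟩
    monomial D m g                                         ∎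
    where
    open ℚP.≤-Reasoning
    swap : ∀ x y z → x * (y * z) ≡ y * (x * z)
    swap = solve-∀ ℚ-ring
  dominated {D} {m} {g} (suc a) b {α} {γ} e₁ e₂ = begin
    ιℕ u * ιℕ u ^ a * (ιℕ v ^ b * monomial α (2 ℕ.+ (a ℕ.* 2 ℕ.+ m)) γ)     ≡⟨ regroup (ιℕ u) (ιℕ u ^ a) (ιℕ v ^ b) _ ⟩
    ιℕ u ^ a * (ιℕ v ^ b * (ιℕ u * monomial α (2 ℕ.+ (a ℕ.* 2 ℕ.+ m)) γ))  ≤⟨ *-monoˡ-≤ (^-nonNeg a (ιℕ-nonNeg u))
                                                                               (*-monoˡ-≤ (^-nonNeg b (ιℕ-nonNeg v)) (trade-c² α (a ℕ.* 2 ℕ.+ m) γ)) ⟩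
    ιℕ u ^ a * (ιℕ v ^ b * monomial (suc α) (a ℕ.* 2 ℕ.+ m) (suc γ))        ≤⟨ dominated {D} {m} {g} a b (trans (cong (ℕ._+ b) (sym (ℕP.+-suc α a))) e₁)
                                                                                             (trans (sym (ℕP.+-suc γ a)) e₂) ⟩
    monomial D m g                                                          ∎
    where
    open ℚP.≤-Reasoning
    regroup : ∀ x xᵃ yᵇ z → x * xᵃ * (yᵇ * z) ≡ xᵃ * (yᵇ * (x * z))
    regroup = solve-∀ ℚ-ring

-- A certificate adds up, over the terms z P^α c^β k^γ of a polynomial, an integer lower bound for
-- scale · z P^α c^β k^γ / (P^D c^m k^g): z · scale for the leading monomial itself, and
-- −|z| · weight a b for a monomial that a and b trades (Dominance.dominated) turn into it.
module Certificate (u v a-max b-max : ℕ) where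

  scale : ℕ
  scale = u ℕ.^ a-max ℕ.* v ℕ.^ b-max

  weight : ℕ → ℕ → ℕ
  weight a b = u ℕ.^ (a-max ℕ.∸ a) ℕ.* v ℕ.^ (b-max ℕ.∸ b)

  record Trades (D m g α β γ : ℕ) : Set where
    constructor trades
    field
      a b : ℕ
      total : α ℕ.+ a ℕ.+ b ≡ D
      c-exp : β ≡ a ℕ.* 2 ℕ.+ m
      k-exp : γ ℕ.+ a ≡ g ℕ.+ b
      a≤a-max : a ℕ.≤ a-max
      b≤b-max : b ℕ.≤ b-max

  trades? : ∀ D m g α β γ → Maybe (Trades D m g α β γ)
  trades? D m g α β γ = try ℕ.⌊ β ℕ.∸ m /2⌋ (D ℕ.∸ α ℕ.∸ ℕ.⌊ β ℕ.∸ m /2⌋)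
    where
    try : ∀ a b → Maybe (Trades D m g α β γ)
    try a b with α ℕ.+ a ℕ.+ b ℕ.≟ D | β ℕ.≟ a ℕ.* 2 ℕ.+ m | γ ℕ.+ a ℕ.≟ g ℕ.+ b | a ℕ.≤? a-max | b ℕ.≤? b-max
    ... | yes e₁ | yes e₂ | yes e₃ | yes a≤ | yes b≤ = just (trades a b e₁ e₂ e₃ a≤ b≤)
    ... | _ | _ | _ | _ | _ = nothing

  contribution : ∀ {D m g α β γ} → ℤ → Trades D m g α β γ → ℤ
  contribution z (trades zero zero _ _ _ _ _) = z ℤ.* + scale
  contribution z (trades a b _ _ _ _ _) = ℤ.- (+ (∣ z ∣ ℕ.* weight a b))

  certificate : (D m g : ℕ) → Poly 3 → Maybe ℤ
  certificate D m g [] = just (+ 0)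
  certificate D m g ((z , α ∷ β ∷ γ ∷ []) ∷ p) with trades? D m g α β γ | certificate D m g p
  ... | just t | just s = just (contribution z t ℤ.+ s)
  ... | _ | _ = nothing

  leadDominates : (D m g : ℕ) → Poly 3 → Bool
  leadDominates D m g p with certificate D m g p
  ... | just (+ suc _) = true
  ... | _ = false

  module Sound {P c k : ℚ} (0<P : 0ℚ < P) (0<c : 0ℚ < c) (0<k : 0ℚ < k)
               (c²-trade : ιℕ u * (c * c) ≤ P * k) (k-trade : ιℕ v * k ≤ P) where

    open Dominance u v (ℚP.<⇒≤ 0<P) (ℚP.<⇒≤ 0<c) (ℚP.<⇒≤ 0<k) c²-trade k-trade

    ρ : Vec ℚ 3
    ρ = P ∷ c ∷ k ∷ []

    scale-split : ∀ a b → a ℕ.≤ a-max → b ℕ.≤ b-max → ιℕ scale ≡ ιℕ (weight a b) * (ιℕ u ^ a * ιℕ v ^ b)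
    scale-split a b a≤ b≤ = begin
      ιℕ scale                                     ≡⟨ cong ιℕ split ⟩
      ιℕ (weight a b ℕ.* (u ℕ.^ a ℕ.* v ℕ.^ b))    ≡⟨ ιℕ-homo-* (weight a b) (u ℕ.^ a ℕ.* v ℕ.^ b) ⟩
      ιℕ (weight a b) * ιℕ (u ℕ.^ a ℕ.* v ℕ.^ b)   ≡⟨ cong (ιℕ (weight a b) *_) (ιℕ-homo-* (u ℕ.^ a) (v ℕ.^ b)) ⟩
      ιℕ (weight a b) * (ιℕ (u ℕ.^ a) * ιℕ (v ℕ.^ b))  ≡⟨ cong (ιℕ (weight a b) *_) (cong₂ _*_ (ιℕ-homo-^ u a) (ιℕ-homo-^ v b)) ⟩
      ιℕ (weight a b) * (ιℕ u ^ a * ιℕ v ^ b)      ∎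
      where
      open ≡-Reasoning
      split : scale ≡ weight a b ℕ.* (u ℕ.^ a ℕ.* v ℕ.^ b)
      split = trans (cong₂ (λ i j → u ℕ.^ i ℕ.* v ℕ.^ j) (sym (ℕP.m∸n+n≡m a≤)) (sym (ℕP.m∸n+n≡m b≤)))
        (trans (cong₂ ℕ._*_ (ℕP.^-distribˡ-+-* u (a-max ℕ.∸ a) a) (ℕP.^-distribˡ-+-* v (b-max ℕ.∸ b) b))
          (*-interchange (u ℕ.^ (a-max ℕ.∸ a)) (u ℕ.^ a) (v ℕ.^ (b-max ℕ.∸ b)) (v ℕ.^ b)))

    -∣z∣x≤zx : ∀ z {x} → 0ℚ ≤ x → - (ιℕ ∣ z ∣ * x) ≤ ι z * x
    -∣z∣x≤zx (+ n) {x} 0≤x = ℚP.≤-trans (ℚP.neg-antimono-≤ (*-nonNeg (ιℕ-nonNeg n) 0≤x)) (*-nonNeg (ιℕ-nonNeg n) 0≤x)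
    -∣z∣x≤zx -[1+ n ] {x} _ = ℚP.≤-reflexive (trans (ℚP.neg-distribˡ-* (ιℕ (suc n)) x) (cong (_* x) (sym (ι-homo‿- (+ suc n)))))

    nonlead-bound : ∀ {D m g α γ} z a b → α ℕ.+ a ℕ.+ b ≡ D → γ ℕ.+ a ≡ g ℕ.+ b → a ℕ.≤ a-max → b ℕ.≤ b-max →
      ι (ℤ.- (+ (∣ z ∣ ℕ.* weight a b))) * monomial D m g ≤ ιℕ scale * (ι z * monomial α (a ℕ.* 2 ℕ.+ m) γ)
    nonlead-bound {D} {m} {g} {α} {γ} z a b e₁ e₂ a≤ b≤ = begin
      ι (ℤ.- (+ (∣ z ∣ ℕ.* weight a b))) * monomial D m g   ≡⟨ cong (_* monomial D m g) coefficient ⟩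
      - (ιℕ ∣ z ∣ * ιℕ (weight a b)) * monomial D m g       ≡⟨ pull (ιℕ ∣ z ∣) (ιℕ (weight a b)) (monomial D m g) ⟩
      - (ιℕ ∣ z ∣ * (ιℕ (weight a b) * monomial D m g))     ≤⟨ ℚP.neg-antimono-≤ (*-monoˡ-≤ (ιℕ-nonNeg ∣ z ∣) scaled) ⟩
      - (ιℕ ∣ z ∣ * (ιℕ scale * X))                         ≡⟨ push (ιℕ ∣ z ∣) (ιℕ scale) X ⟩
      ιℕ scale * - (ιℕ ∣ z ∣ * X)                           ≤⟨ *-monoˡ-≤ (ιℕ-nonNeg scale) (-∣z∣x≤zx z (monomial-nonNeg α (a ℕ.* 2 ℕ.+ m) γ)) ⟩
      ιℕ scale * (ι z * X)                                  ∎
      where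
      open ℚP.≤-Reasoning
      X = monomial α (a ℕ.* 2 ℕ.+ m) γ
      coefficient : ι (ℤ.- (+ (∣ z ∣ ℕ.* weight a b))) ≡ - (ιℕ ∣ z ∣ * ιℕ (weight a b))
      coefficient = trans (ι-homo‿- (+ (∣ z ∣ ℕ.* weight a b))) (cong -_ (ιℕ-homo-* ∣ z ∣ (weight a b)))
      pull : ∀ x y z → - (x * y) * z ≡ - (x * (y * z))
      pull = solve-∀ ℚ-ring
      push : ∀ x y z → - (x * (y * z)) ≡ y * - (x * z)
      push = solve-∀ ℚ-ring
      scaled : ιℕ scale * X ≤ ιℕ (weight a b) * monomial D m g
      scaled = begin
        ιℕ scale * X                                          ≡⟨ cong (_* X) (scale-split a b a≤ b≤) ⟩
        ιℕ (weight a b) * (ιℕ u ^ a * ιℕ v ^ b) * X            ≡⟨ assoc3 (ιℕ (weight a b)) (ιℕ u ^ a) (ιℕ v ^ b) X ⟩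
        ιℕ (weight a b) * (ιℕ u ^ a * (ιℕ v ^ b * X))          ≤⟨ *-monoˡ-≤ (ιℕ-nonNeg (weight a b)) (dominated a b e₁ e₂) ⟩
        ιℕ (weight a b) * monomial D m g                       ∎
        where
        assoc3 : ∀ w x y z → w * (x * y) * z ≡ w * (x * (y * z))
        assoc3 = solve-∀ ℚ-ring

    contribution-bound : ∀ {D m g α β γ} z (t : Trades D m g α β γ) →
      ι (contribution z t) * monomial D m g ≤ ιℕ scale * (ι z * monomial α β γ)
    contribution-bound {D} {m} {g} {α} {β} {γ} z (trades zero zero e₁ refl e₃ _ _)
      with trans (sym (trans (ℕP.+-identityʳ (α ℕ.+ 0)) (ℕP.+-identityʳ α))) e₁
         | trans (sym (ℕP.+-identityʳ γ)) (trans e₃ (ℕP.+-identityʳ g))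
    ... | refl | refl = ℚP.≤-reflexive
      (trans (cong (_* monomial α m γ) (ι-homo-* z (+ scale))) (swap (ι z) (ιℕ scale) (monomial α m γ)))
      where
      swap : ∀ x y z → x * y * z ≡ y * (x * z)
      swap = solve-∀ ℚ-ring
    contribution-bound {D} {m} {g} z (trades zero (suc b) e₁ refl e₃ a≤ b≤) =
      nonlead-bound {D} {m} {g} z zero (suc b) e₁ e₃ a≤ b≤
    contribution-bound {D} {m} {g} z (trades (suc a) b e₁ refl e₃ a≤ b≤) =
      nonlead-bound {D} {m} {g} z (suc a) b e₁ e₃ a≤ b≤

    certificate-sound : ∀ D m g p {s} → certificate D m g p ≡ just s →
      ι s * monomial D m g ≤ ιℕ scale * ⟦ p ⟧ₚ ρ
    certificate-sound D m g [] refl = ℚP.≤-reflexive (trans (ℚP.*-zeroˡ (monomial D m g)) (sym (ℚP.*-zeroʳ (ιℕ scale))))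
    certificate-sound D m g ((z , α ∷ β ∷ γ ∷ []) ∷ p) eq with trades? D m g α β γ | certificate D m g p in eq′
    ... | just t | just s with refl ← eq = begin
      ι (contribution z t ℤ.+ s) * monomial D m g                                ≡⟨ cong (_* monomial D m g) (ι-homo-+ (contribution z t) s) ⟩
      (ι (contribution z t) + ι s) * monomial D m g                              ≡⟨ ℚP.*-distribʳ-+ (monomial D m g) (ι (contribution z t)) (ι s) ⟩
      ι (contribution z t) * monomial D m g + ι s * monomial D m g               ≤⟨ ℚP.+-mono-≤ (contribution-bound z t) (certificate-sound D m g p eq′) ⟩
      ιℕ scale * (ι z * monomial α β γ) + ιℕ scale * ⟦ p ⟧ₚ ρ    ≡⟨ ℚP.*-distribˡ-+ (ιℕ scale) (ι z * monomial α β γ) (⟦ p ⟧ₚ ρ) ⟨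
      ιℕ scale * ⟦ (z , α ∷ β ∷ γ ∷ []) ∷ p ⟧ₚ ρ                  ∎
      where open ℚP.≤-Reasoning
    ... | just _ | nothing with () ← eq
    ... | nothing | _ with () ← eq

    leadDominates⇒pos : ∀ D m g p → leadDominates D m g p ≡ true → 0ℚ < ⟦ p ⟧ₚ ρ
    leadDominates⇒pos D m g p dom with certificate D m g p in eq
    ... | just (+ suc n) = *-pos⇒pos (ιℕ-nonNeg scale) (ℚP.<-≤-trans
      (*-pos (ιℕ-pos (suc n)) (*-pos (^-pos D 0<P) (*-pos (^-pos m 0<c) (*-pos (^-pos g 0<k) (ℚP.positive⁻¹ 1ℚ)))))
      (certificate-sound D m g p eq))

x₀ : ∀ {n} → Expr (suc n)
x₀ = var zero
x₁ : ∀ {n} → Expr (2 ℕ.+ n)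
x₁ = var (suc zero)
x₂ : ∀ {n} → Expr (3 ℕ.+ n)
x₂ = var (suc (suc zero))
x₃ : ∀ {n} → Expr (4 ℕ.+ n)
x₃ = var (suc (suc (suc zero)))
x₄ : ∀ {n} → Expr (5 ℕ.+ n)
x₄ = var (suc (suc (suc (suc zero))))
x₅ : ∀ {n} → Expr (6 ℕ.+ n)
x₅ = var (suc (suc (suc (suc (suc zero)))))
x₆ : ∀ {n} → Expr (7 ℕ.+ n)
x₆ = var (suc (suc (suc (suc (suc (suc zero))))))

a₈ a₆ a₄ a₂ a₀ : ∀ {n} → Expr n → Expr n → Expr n
a₈ p q = (con (+ 2) ⊗ q ⊛ 2 ⊕ p ⊛ 2) ⊗ (con (+ 3) ⊗ q ⊛ 2 ⊖ con (+ 2) ⊗ p ⊛ 2)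
a₆ p q = q ⊛ 8 ⊕ con (+ 10) ⊗ p ⊛ 2 ⊗ q ⊛ 6 ⊕ con (+ 4) ⊗ p ⊛ 4 ⊗ q ⊛ 4 ⊖ con (+ 14) ⊗ p ⊛ 6 ⊗ q ⊛ 2 ⊕ p ⊛ 8
a₄ p q = p ⊛ 2 ⊗ q ⊛ 2 ⊗ (q ⊛ 8 ⊖ con (+ 14) ⊗ p ⊛ 2 ⊗ q ⊛ 6 ⊕ con (+ 4) ⊗ p ⊛ 4 ⊗ q ⊛ 4
                         ⊕ con (+ 10) ⊗ p ⊛ 6 ⊗ q ⊛ 2 ⊕ p ⊛ 8)
a₂ p q = p ⊛ 6 ⊗ q ⊛ 6 ⊗ (q ⊛ 2 ⊕ con (+ 2) ⊗ p ⊛ 2) ⊗ (con (+ 3) ⊗ p ⊛ 2 ⊖ con (+ 2) ⊗ q ⊛ 2)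
a₀ p q = q ⊛ 10 ⊗ p ⊛ 10

coefficients : ℚ → ℚ → Vec ℚ 5
coefficients p q = ⟦ a₈ x₀ x₁ ⟧ ρ ∷ ⟦ a₆ x₀ x₁ ⟧ ρ ∷ ⟦ a₄ x₀ x₁ ⟧ ρ ∷ ⟦ a₂ x₀ x₁ ⟧ ρ ∷ ⟦ a₀ x₀ x₁ ⟧ ρ ∷ []
  where ρ = p ∷ q ∷ []

Q-form : ∀ {n} (t A₈ A₆ A₄ A₂ A₀ : Expr n) → Expr n
Q-form t A₈ A₆ A₄ A₂ A₀ = t ⊛ 10 ⊕ A₈ ⊗ t ⊛ 8 ⊕ A₆ ⊗ t ⊛ 6 ⊖ A₄ ⊗ t ⊛ 4 ⊖ A₂ ⊗ t ⊛ 2 ⊖ A₀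

-- N¹⁰ Q(T / N), a form of degree 10 in T and N.
homogenised-form : ∀ {n} (T N A₈ A₆ A₄ A₂ A₀ : Expr n) → Expr n
homogenised-form T N A₈ A₆ A₄ A₂ A₀ =
  T ⊛ 10 ⊕ A₈ ⊗ T ⊛ 8 ⊗ N ⊛ 2 ⊕ A₆ ⊗ T ⊛ 6 ⊗ N ⊛ 4 ⊖ A₄ ⊗ T ⊛ 4 ⊗ N ⊛ 6 ⊖ A₂ ⊗ T ⊛ 2 ⊗ N ⊛ 8 ⊖ A₀ ⊗ N ⊛ 10

Q-coefficients : ℚ → ℚ → List ℚ
Q-coefficients p q with coefficients p q
... | A₈ ∷ A₆ ∷ A₄ ∷ A₂ ∷ A₀ ∷ [] = - A₀ ∷ 0ℚ ∷ - A₂ ∷ 0ℚ ∷ - A₄ ∷ 0ℚ ∷ A₆ ∷ 0ℚ ∷ A₈ ∷ 0ℚ ∷ 1ℚ ∷ []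

Q≡horner : ∀ p q t → Q p q t ≡ horner (Q-coefficients p q) t
Q≡horner p q t = ≡-by-normalise (Q-form x₀ x₁ x₂ x₃ x₄ x₅) horner-form refl (t ∷ coefficients p q)
  where
  horner-form : Expr 6
  horner-form = ⊝ x₅ ⊕ x₀ ⊗ (con (+ 0) ⊕ x₀ ⊗ (⊝ x₄ ⊕ x₀ ⊗ (con (+ 0) ⊕ x₀ ⊗ (⊝ x₃ ⊕ x₀ ⊗ (con (+ 0)
    ⊕ x₀ ⊗ (x₂ ⊕ x₀ ⊗ (con (+ 0) ⊕ x₀ ⊗ (x₁ ⊕ x₀ ⊗ (con (+ 0) ⊕ x₀ ⊗ (con (+ 1) ⊕ x₀ ⊗ con (+ 0)))))))))))

Qₕ : ℚ → ℚ → ℚ → ℚ → ℚ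
Qₕ p q T N = ⟦ homogenised-form x₀ x₁ x₂ x₃ x₄ x₅ x₆ ⟧ (T ∷ N ∷ coefficients p q)

homogenise : ∀ p q t N → N ^ 10 * Q p q t ≡ Qₕ p q (N * t) N
homogenise p q t N = ≡-by-normalise (x₁ ⊛ 10 ⊗ Q-form x₀ x₂ x₃ x₄ x₅ x₆)
  (homogenised-form (x₁ ⊗ x₀) x₁ x₂ x₃ x₄ x₅ x₆) refl (t ∷ N ∷ coefficients p q)

-- For e = p̃ and N = P + e = B q̃³ one has N F₃ = T₁ and N² (F₃ + D) = T₂ (see Endpoints below), so
-- endpoint₁ and endpoint₂ are p̃ N¹⁰ Q̃(F₃) and p̃ N²⁰ Q̃(F₃ + D).
T₁ T₂ : ∀ {n} → Expr n → Expr n → Expr n → Expr n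
T₁ P c e = (P ⊕ e) ⊗ P ⊗ c ⊕ con (+ 16) ⊗ c ⊛ 3
T₂ P c e = (P ⊕ e) ⊛ 2 ⊗ P ⊗ c ⊕ con (+ 16) ⊗ c ⊛ 3 ⊗ (P ⊕ con (+ 3) ⊗ e)

endpoint₁ endpoint₂ : ∀ {n} → Expr n → Expr n → Expr n → Expr n
endpoint₁ P c e = e ⊗ homogenised-form (T₁ P c e) (P ⊕ e) (a₈ P c) (a₆ P c) (a₄ P c) (a₂ P c) (a₀ P c)
endpoint₂ P c e = e ⊗ homogenised-form (T₂ P c e) ((P ⊕ e) ⊛ 2) (a₈ P c) (a₆ P c) (a₄ P c) (a₂ P c) (a₀ P c)

-- In the variables (P, q̃, k) the leading monomial is P^D q̃⁸ k²; the trades are 6 q̃² ≤ P k, used at most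
-- 11 times, and 342 k ≤ P, used at most 24 times.
open Certificate 6 342 11 24 using (leadDominates; module Sound)

endpoint₁-k : leadDominates 21 8 2 (normalise (⊝ endpoint₁ x₀ x₁ x₂)) ≡ true
endpoint₁-k = refl

endpoint₁-neg-k : leadDominates 21 8 2 (normalise (⊝ endpoint₁ x₀ x₁ (⊝ x₂))) ≡ true
endpoint₁-neg-k = refl

endpoint₂-k : leadDominates 31 8 2 (normalise (endpoint₂ x₀ x₁ x₂)) ≡ true
endpoint₂-k = refl

endpoint₂-neg-k : leadDominates 31 8 2 (normalise (endpoint₂ x₀ x₁ (⊝ x₂))) ≡ true
endpoint₂-neg-k = refl

module EndpointSigns {P c k : ℚ} (0<P : 0ℚ < P) (0<c : 0ℚ < c) (0<k : 0ℚ < k)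
                     (c²-trade : ιℕ 6 * (c * c) ≤ P * k) (k-trade : ιℕ 342 * k ≤ P) where

  open Sound 0<P 0<c 0<k c²-trade k-trade

  certified-pos : ∀ D E → leadDominates D 8 2 (normalise E) ≡ true → 0ℚ < ⟦ E ⟧ (P ∷ c ∷ k ∷ [])
  certified-pos D E dom = subst (0ℚ <_) (normalise-sound E (P ∷ c ∷ k ∷ [])) (leadDominates⇒pos D 8 2 (normalise E) dom)

  endpoint-signs : ∀ {e} → e ≡ k ⊎ e ≡ - k →
    ⟦ endpoint₁ x₀ x₁ x₂ ⟧ (P ∷ c ∷ e ∷ []) < 0ℚ × 0ℚ < ⟦ endpoint₂ x₀ x₁ x₂ ⟧ (P ∷ c ∷ e ∷ [])
  endpoint-signs (inj₁ refl) =
    0<-p⇒p<0 (certified-pos 21 (⊝ endpoint₁ x₀ x₁ x₂) endpoint₁-k) ,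
    certified-pos 31 (endpoint₂ x₀ x₁ x₂) endpoint₂-k
  endpoint-signs (inj₂ refl) =
    0<-p⇒p<0 (certified-pos 21 (⊝ endpoint₁ x₀ x₁ (⊝ x₂)) endpoint₁-neg-k) ,
    certified-pos 31 (endpoint₂ x₀ x₁ (⊝ x₂)) endpoint₂-neg-k

7≤∛ : ∀ q k → 1 ℕ.≤ k → 343 ℕ.* k ℕ.≤ q ℕ.^ 3 → 7 ℕ.≤ q
7≤∛ q k 1≤k 343k≤q³ with 7 ℕ.≤? q
... | yes 7≤q = 7≤q
... | no 7≰q = ⊥-elim (ℕP.<-irrefl refl (ℕP.<-≤-trans 216<343 (ℕP.≤-trans (ℕP.*-monoʳ-≤ 343 1≤k)
    (ℕP.≤-trans 343k≤q³ (ℕP.^-monoˡ-≤ 3 (ℕP.≤-pred (ℕP.≰⇒> 7≰q)))))))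
  where
  216<343 : 6 ℕ.^ 3 ℕ.< 343 ℕ.* 1
  216<343 = ℕP.m≤m+n 217 126

trade-inequalities : ∀ {X c k e} → ιℕ 7 ≤ c → 1ℚ ≤ k → ιℕ 343 * k ≤ c ^ 3 → c ^ 3 ≤ X → e ≤ k →
  ιℕ 6 * (c * c) ≤ (X - e) * k × ιℕ 342 * k ≤ X - e
trade-inequalities {X} {c} {k} {e} 7≤c 1≤k 343k≤c³ c³≤X e≤k = c²-trade , k-trade
  where
  open ℚP.≤-Reasoning
  c³-k≤X-e : c ^ 3 - k ≤ X - e
  c³-k≤X-e = ℚP.+-mono-≤ c³≤X (ℚP.neg-antimono-≤ e≤k)
  k-trade : ιℕ 342 * k ≤ X - e
  k-trade = begin
    ιℕ 342 * k          ≡⟨ 342k≡343k-k k ⟩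
    ιℕ 343 * k - k      ≤⟨ ℚP.+-monoˡ-≤ (- k) 343k≤c³ ⟩
    c ^ 3 - k           ≤⟨ c³-k≤X-e ⟩
    X - e               ∎
    where
    342k≡343k-k : ∀ k → ιℕ 342 * k ≡ ιℕ 343 * k - k
    342k≡343k-k = solve-∀ ℚ-ring
  0≤X-e : 0ℚ ≤ X - e
  0≤X-e = ℚP.≤-trans (*-nonNeg (ιℕ-nonNeg 342) (ℚP.≤-trans (ℚP.nonNegative⁻¹ 1ℚ) 1≤k)) k-trade
  -- 343 · 6 ≤ 342 · 7 is what q̃ ≥ 7 buys.
  6c²≤X-e : ιℕ 6 * (c * c) ≤ X - e
  6c²≤X-e = *-cancelˡ-≤ (ιℕ-pos 343) (begin
    ιℕ 343 * (ιℕ 6 * (c * c))         ≡⟨ 343·6≡2058 (c * c) ⟩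
    ιℕ 2058 * (c * c)                 ≤⟨ *-monoʳ-≤ (*-nonNeg (ℚP.<⇒≤ 0<c) (ℚP.<⇒≤ 0<c)) (ιℕ-mono-≤ (ℕP.m≤m+n 2058 336)) ⟩
    ιℕ 2394 * (c * c)                 ≡⟨ 2394≡342·7 (c * c) ⟩
    ιℕ 342 * (ιℕ 7 * (c * c))         ≤⟨ *-monoˡ-≤ (ιℕ-nonNeg 342) (*-monoʳ-≤ (*-nonNeg (ℚP.<⇒≤ 0<c) (ℚP.<⇒≤ 0<c)) 7≤c) ⟩
    ιℕ 342 * (c * (c * c))            ≡⟨ 342y≡343y-y c ⟩
    ιℕ 343 * c ^ 3 - c ^ 3            ≤⟨ ℚP.+-monoʳ-≤ (ιℕ 343 * c ^ 3) (ℚP.neg-antimono-≤ 343k≤c³) ⟩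
    ιℕ 343 * c ^ 3 - ιℕ 343 * k       ≡⟨ factor (ιℕ 343) (c ^ 3) k ⟩
    ιℕ 343 * (c ^ 3 - k)              ≤⟨ *-monoˡ-≤ (ιℕ-nonNeg 343) c³-k≤X-e ⟩
    ιℕ 343 * (X - e)                  ∎)
    where
    0<c : 0ℚ < c
    0<c = ℚP.<-≤-trans (ιℕ-pos 7) 7≤c
    343·6≡2058 : ∀ x → ιℕ 343 * (ιℕ 6 * x) ≡ ιℕ 2058 * x
    343·6≡2058 = solve-∀ ℚ-ring
    2394≡342·7 : ∀ x → ιℕ 2394 * x ≡ ιℕ 342 * (ιℕ 7 * x)
    2394≡342·7 = solve-∀ ℚ-ring
    342y≡343y-y : ∀ c → ιℕ 342 * (c * (c * c)) ≡ ιℕ 343 * (c * (c * (c * 1ℚ))) - c * (c * (c * 1ℚ))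
    342y≡343y-y = solve-∀ ℚ-ring
    factor : ∀ a y k → a * y - a * k ≡ a * (y - k)
    factor = solve-∀ ℚ-ring
  c²-trade : ιℕ 6 * (c * c) ≤ (X - e) * k
  c²-trade = ℚP.≤-trans 6c²≤X-e (ℚP.≤-trans (ℚP.≤-reflexive (sym (ℚP.*-identityʳ (X - e)))) (*-monoˡ-≤ 0≤X-e 1≤k))

ι≡±ιℕ∣∣ : ∀ z → ι z ≡ ιℕ ∣ z ∣ ⊎ ι z ≡ - ιℕ ∣ z ∣
ι≡±ιℕ∣∣ (+ n) = inj₁ refl
ι≡±ιℕ∣∣ -[1+ n ] = inj₂ (ι-homo‿- (+ suc n))

ι-pos : ∀ {z} → + 0 ℤ.< z → 0ℚ < ι z
ι-pos {+ zero} (ℤ.+<+ ())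
ι-pos {+ suc n} _ = ιℕ-pos (suc n)

ι-neg : ∀ {z} → z ℤ.< + 0 → ι z < 0ℚ
ι-neg {+ n} (ℤ.+<+ ())
ι-neg { -[1+ n ]} _ = subst (_< 0ℚ) (sym (ι-homo‿- (+ suc n))) (ℚP.neg-antimono-< (ιℕ-pos (suc n)))

1≤∣z∣ : ∀ {z} → ¬ z ≡ + 0 → 1 ℕ.≤ ∣ z ∣
1≤∣z∣ {+ zero} z≢0 = ⊥-elim (z≢0 refl)
1≤∣z∣ {+ suc n} _ = ℕ.s≤s ℕ.z≤n
1≤∣z∣ { -[1+ n ]} _ = ℕ.s≤s ℕ.z≤n

module Endpoints (B : ℕ) (pt : ℤ) (qt : ℕ) (1≤B : 1 ℕ.≤ B) (1≤qt : 1 ℕ.≤ qt) (pt≢0 : ¬ pt ≡ + 0)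
                 (343∣pt∣≤qt³ : 343 ℕ.* ∣ pt ∣ ℕ.≤ qt ℕ.^ 3) where

  β c e k P N F d : ℚ
  β = ιℕ B
  c = ιℕ qt
  e = ι pt
  k = ιℕ ∣ pt ∣
  P = β * c ^ 3 - e
  N = P + e
  F = F3 B pt qt
  d = D B pt qt

  0<c : 0ℚ < c
  0<c = ℚP.<-≤-trans (ιℕ-pos 1) (ιℕ-mono-≤ 1≤qt)

  1≤k : 1ℚ ≤ k
  1≤k = ιℕ-mono-≤ (1≤∣z∣ pt≢0)

  0<k : 0ℚ < k
  0<k = ℚP.<-≤-trans (ℚP.positive⁻¹ 1ℚ) 1≤k

  e≤k : e ≤ k
  e≤k with ι≡±ιℕ∣∣ pt
  ... | inj₁ e≡k = ℚP.≤-reflexive e≡k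
  ... | inj₂ e≡-k = ℚP.≤-trans (ℚP.≤-reflexive e≡-k) (ℚP.≤-trans (ℚP.neg-antimono-≤ (ℚP.<⇒≤ 0<k)) (ℚP.<⇒≤ 0<k))

  c³≤βc³ : c ^ 3 ≤ β * c ^ 3
  c³≤βc³ = ℚP.≤-trans (ℚP.≤-reflexive (sym (ℚP.*-identityˡ (c ^ 3)))) (*-monoʳ-≤ (^-nonNeg 3 (ℚP.<⇒≤ 0<c)) (ιℕ-mono-≤ 1≤B))

  343k≤c³ : ιℕ 343 * k ≤ c ^ 3
  343k≤c³ = subst₂ _≤_ (ιℕ-homo-* 343 ∣ pt ∣) (ιℕ-homo-^ qt 3) (ιℕ-mono-≤ 343∣pt∣≤qt³)

  trade-bounds : ιℕ 6 * (c * c) ≤ P * k × ιℕ 342 * k ≤ P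
  trade-bounds = trade-inequalities (ιℕ-mono-≤ (7≤∛ qt ∣ pt ∣ (1≤∣z∣ pt≢0) 343∣pt∣≤qt³)) 1≤k 343k≤c³ c³≤βc³ e≤k

  0<P : 0ℚ < P
  0<P = ℚP.<-≤-trans (*-pos (ιℕ-pos 342) 0<k) (proj₂ trade-bounds)

  0<N : 0ℚ < N
  0<N = subst (0ℚ <_) (sym (q-p+p≡q e (β * c ^ 3))) (*-pos (ιℕ-pos B {{ℕ.>-nonZero 1≤B}}) (^-pos 3 0<c))

  βs≡16 : β * over (+ 16) B ≡ ι (+ 16)
  βs≡16 = ιℕ*over (+ 16) 1≤B

  β²c³d≡32e : β ^ 2 * c ^ 3 * d ≡ ι (+ 32) * e
  β²c³d≡32e = begin
    β ^ 2 * c ^ 3 * d                     ≡⟨ cong (_* d) B²q³≡β²c³ ⟨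
    ιℕ (B ℕ.^ 2 ℕ.* qt ℕ.^ 3) * d         ≡⟨ ιℕ*over (+ 32 ℤ.* pt) (ℕP.*-mono-≤ (ℕP.^-monoˡ-≤ 2 1≤B) (ℕP.^-monoˡ-≤ 3 1≤qt)) ⟩
    ι (+ 32 ℤ.* pt)                       ≡⟨ ι-homo-* (+ 32) pt ⟩
    ι (+ 32) * e                          ∎
    where
    open ≡-Reasoning
    B²q³≡β²c³ : ιℕ (B ℕ.^ 2 ℕ.* qt ℕ.^ 3) ≡ β ^ 2 * c ^ 3
    B²q³≡β²c³ = trans (ιℕ-homo-* (B ℕ.^ 2) (qt ℕ.^ 3)) (cong₂ _*_ (ιℕ-homo-^ B 2) (ιℕ-homo-^ qt 3))

  -- Clearing the denominators of F₃ and D; the variables are β, q̃, p̃, 16/B and D.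
  P′ N′ F′ : Expr 5
  P′ = x₀ ⊗ x₁ ⊛ 3 ⊖ x₂
  N′ = P′ ⊕ x₂
  F′ = x₀ ⊗ x₁ ⊛ 4 ⊖ x₂ ⊗ x₁ ⊕ x₃

  ρ : Vec ℚ 5
  ρ = β ∷ c ∷ e ∷ over (+ 16) B ∷ d ∷ []

  N·F≡T₁ : N * F ≡ ⟦ T₁ x₀ x₁ x₂ ⟧ (P ∷ c ∷ e ∷ [])
  N·F≡T₁ = begin
    N * F                                 ≡⟨ ≡-by-normalise (N′ ⊗ F′) (N′ ⊗ P′ ⊗ x₁ ⊕ (x₀ ⊗ x₃) ⊗ x₁ ⊛ 3) refl ρ ⟩
    N * P * c + β * over (+ 16) B * c ^ 3  ≡⟨ cong (λ βs → N * P * c + βs * c ^ 3) βs≡16 ⟩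
    ⟦ T₁ x₀ x₁ x₂ ⟧ (P ∷ c ∷ e ∷ [])      ∎
    where open ≡-Reasoning

  N²·[F+d]≡T₂ : N ^ 2 * (F + d) ≡ ⟦ T₂ x₀ x₁ x₂ ⟧ (P ∷ c ∷ e ∷ [])
  N²·[F+d]≡T₂ = begin
    N ^ 2 * (F + d)                                                         ≡⟨ ≡-by-normalise (N′ ⊛ 2 ⊗ (F′ ⊕ x₄)) expanded refl ρ ⟩
    N ^ 2 * P * c + β * over (+ 16) B * c ^ 3 * N + β ^ 2 * c ^ 3 * d * c ^ 3 ≡⟨ cong₂ (λ βs β²c³d → N ^ 2 * P * c + βs * c ^ 3 * N + β²c³d * c ^ 3)
                                                                                        βs≡16 β²c³d≡32e ⟩
    N ^ 2 * P * c + ι (+ 16) * c ^ 3 * N + ι (+ 32) * e * c ^ 3              ≡⟨ ≡-by-normalise substituted (T₂ x₀ x₁ x₂) refl (P ∷ c ∷ e ∷ []) ⟩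
    ⟦ T₂ x₀ x₁ x₂ ⟧ (P ∷ c ∷ e ∷ [])                                         ∎
    where
    open ≡-Reasoning
    expanded : Expr 5
    expanded = N′ ⊛ 2 ⊗ P′ ⊗ x₁ ⊕ (x₀ ⊗ x₃) ⊗ x₁ ⊛ 3 ⊗ N′ ⊕ (x₀ ⊛ 2 ⊗ x₁ ⊛ 3 ⊗ x₄) ⊗ x₁ ⊛ 3
    substituted : Expr 3
    substituted = (x₀ ⊕ x₂) ⊛ 2 ⊗ x₀ ⊗ x₁ ⊕ con (+ 16) ⊗ x₁ ⊛ 3 ⊗ (x₀ ⊕ x₂) ⊕ con (+ 32) ⊗ x₂ ⊗ x₁ ⊛ 3

  dehomogenise : ∀ M t → e * Qₕ P c (M * t) M ≡ M ^ 10 * (e * Q P c t)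
  dehomogenise M t = trans (cong (e *_) (sym (homogenise P c t M))) (swap e (M ^ 10) (Q P c t))
    where
    swap : ∀ x y z → x * (y * z) ≡ y * (x * z)
    swap = solve-∀ ℚ-ring

  open EndpointSigns 0<P 0<c 0<k (proj₁ trade-bounds) (proj₂ trade-bounds)

  e·Q[F]<0 : e * Q P c F < 0ℚ
  e·Q[F]<0 = *-neg⇒neg (^-pos 10 0<N) (subst (_< 0ℚ) value (proj₁ (endpoint-signs (ι≡±ιℕ∣∣ pt))))
    where
    value : ⟦ endpoint₁ x₀ x₁ x₂ ⟧ (P ∷ c ∷ e ∷ []) ≡ N ^ 10 * (e * Q P c F)
    value = trans (cong (λ T → e * Qₕ P c T N) (sym N·F≡T₁)) (dehomogenise N F)

  0<e·Q[F+d] : 0ℚ < e * Q P c (F + d)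
  0<e·Q[F+d] = *-pos⇒pos (ℚP.<⇒≤ (^-pos 10 (^-pos 2 0<N)))
    (subst (0ℚ <_) value (proj₂ (endpoint-signs (ι≡±ιℕ∣∣ pt))))
    where
    value : ⟦ endpoint₂ x₀ x₁ x₂ ⟧ (P ∷ c ∷ e ∷ []) ≡ (N ^ 2) ^ 10 * (e * Q P c (F + d))
    value = trans (cong (λ T → e * Qₕ P c T (N ^ 2)) (sym N²·[F+d]≡T₂)) (dehomogenise (N ^ 2) (F + d))

  0<β²c³ : 0ℚ < β ^ 2 * c ^ 3
  0<β²c³ = *-pos (^-pos 2 (ℚP.<-≤-trans (ιℕ-pos 1) (ιℕ-mono-≤ 1≤B))) (^-pos 3 0<c)

  0<e⇒0<d : 0ℚ < e → 0ℚ < d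
  0<e⇒0<d 0<e = *-pos⇒pos (ℚP.<⇒≤ 0<β²c³) (subst (0ℚ <_) (sym β²c³d≡32e) (*-pos (ιℕ-pos 32) 0<e))

  e<0⇒d<0 : e < 0ℚ → d < 0ℚ
  e<0⇒d<0 e<0 = *-neg⇒neg 0<β²c³ (subst (_< 0ℚ) (sym β²c³d≡32e) 32e<0)
    where
    32e<0 : ι (+ 32) * e < 0ℚ
    32e<0 = subst (ι (+ 32) * e <_) (ℚP.*-zeroʳ (ι (+ 32))) (ℚP.*-monoʳ-<-pos (ι (+ 32)) {{positive (ιℕ-pos 32)}} e<0)

theorem4p3 : (B : ℕ) → 1 ℕ.≤ B → B ℕ.≤ 9 → (pt : ℤ) → ¬ (pt ≡ + 0) →
    (qt : ℕ) → 1 ℕ.≤ qt → 343 ℕ.* ∣ pt ∣ ℕ.≤ qt ℕ.^ 3 →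
    (pt ℤ.< + 0 → HasRealRootIn (Qtilde B pt qt) (F3 B pt qt + D B pt qt) (F3 B pt qt))
    × (+ 0 ℤ.< pt → HasRealRootIn (Qtilde B pt qt) (F3 B pt qt) (F3 B pt qt + D B pt qt))
theorem4p3 B 1≤B _ pt pt≢0 qt 1≤qt 343∣pt∣≤qt³ = root-below , root-above
  where
  open Endpoints B pt qt 1≤B 1≤qt pt≢0 343∣pt∣≤qt³
  root : ∀ {a b} → a ≤ b → Q P c a < 0ℚ → 0ℚ < Q P c b → HasRealRootIn (Qtilde B pt qt) a b
  root = polynomial-root (Qtilde B pt qt) (Q-coefficients P c) (Q≡horner P c)
  root-below : pt ℤ.< + 0 → HasRealRootIn (Qtilde B pt qt) (F + d) F
  root-below pt<0 = root (p+q≤p (ℚP.<⇒≤ (e<0⇒d<0 e<0))) (neg*pos⇒neg e<0 0<e·Q[F+d]) (neg*neg⇒pos e<0 e·Q[F]<0)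
    where e<0 = ι-neg pt<0
  root-above : + 0 ℤ.< pt → HasRealRootIn (Qtilde B pt qt) F (F + d)
  root-above 0<pt = root (p≤p+q (ℚP.<⇒≤ (0<e⇒0<d 0<e))) (*-neg⇒neg 0<e e·Q[F]<0) (*-pos⇒pos (ℚP.<⇒≤ 0<e) 0<e·Q[F+d])
    where 0<e = ι-pos 0<pt
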